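{- Let $a\ge 1$ and $n\ge 2$ be integers, and let $\overline{W}_n$ be the graph obtained from the cycle graph $C_n$ with vertices $p_1,\dots,p_n$ by adding a new vertex $p$ joined to each $p_j$ by $a$ parallel edges. Then $t(\overline{W}_n)=a\,W_{n-1}(a)$. In particular, for $a=1$, $t(W_n)=L_{2n}-2$, where $L_k$ is the $k$-th Lucas number.
   Context: $t(H)$ denotes the number of spanning trees of a graph $H$. $C_n$ is the cycle on $n$ vertices ($C_2$ consists of two vertices joined by two parallel edges). The polynomials $W_n(x)$ are defined by $W_0(x)=1$, $W_1(x)=x+4$, $W_n(x)=(x+2)W_{n-1}(x)-W_{n-2}(x)+2$ for $n\ge 2$. $W_n$ (the wheel graph) denotes $\overline{W}_n$ with $a=1$. Lucas numbers: $L_1=1$, $L_2=3$, $L_k=L_{k-1}+L_{k-2}$. -}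

module Defs where

open import Data.Nat using (ℕ; zero; suc; _+_; _∸_)
open import Data.Integer as ℤ using (ℤ; +_)
open import Data.Fin using (Fin; zero; suc; inject₁; fromℕ)
open import Data.Fin.Subset using (Subset; _∈_)
open import Data.List using (List; []; _∷_; _++_; map; concatMap; replicate; length; lookup)
open import Data.List.Base using (allFin)
open import Data.Product using (_×_; _,_; proj₁; proj₂)
open import Data.Refinement using (Refinement)
open import Function.Bundles using (_↔_)
open import Relation.Binary.PropositionalEquality using (_≢_)
open import Relation.Nullary using (¬_)

-- Finite multigraphs: vertex set Fin V, an explicit list of edges
-- (each edge an unordered pair of endpoints, stored as a pair).
-- Parallel edges are distinct list entries, hence distinct edges.

record Graph : Set where
  field
    V     : ℕ
    edges : List (Fin V × Fin V)

open Graph public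

E : Graph → ℕ
E G = length (edges G)

src tgt : (G : Graph) → Fin (E G) → Fin (V G)
src G e = proj₁ (lookup (edges G) e)
tgt G e = proj₂ (lookup (edges G) e)

data Reach (G : Graph) (P : Fin (E G) → Set) : Fin (V G) → Fin (V G) → Set where
  here  : ∀ {u} → Reach G P u u
  fwd   : ∀ {w} (e : Fin (E G)) → P e → Reach G P (tgt G e) w → Reach G P (src G e) w
  bwd   : ∀ {w} (e : Fin (E G)) → P e → Reach G P (src G e) w → Reach G P (tgt G e) w

-- Acyclic: no edge of S
-- lies on a cycle, i.e. removing any e ∈ S leaves its endpoints
-- disconnected (this also excludes loops and parallel pairs).
Connected : (G : Graph) → Subset (E G) → Set
Connected G S = ∀ u v → Reach G (_∈ S) u v

Acyclic : (G : Graph) → Subset (E G) → Set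
Acyclic G S = ∀ e → e ∈ S → ¬ Reach G (λ f → f ∈ S × f ≢ e) (src G e) (tgt G e)

IsSpanningTree : (G : Graph) → Subset (E G) → Set
IsSpanningTree G S = Connected G S × Acyclic G S

SpanningTree : Graph → Set
SpanningTree G = Refinement (Subset (E G)) (IsSpanningTree G)

_hasSpanningTreeCount_ : Graph → ℕ → Set
G hasSpanningTreeCount k = SpanningTree G ↔ Fin k

-- The cycle C_{k+1} on vertices Fin (suc k): edges {i,i+1} for i < k and
-- the closing edge {k,0}.  For k = 1 this is C_2 (two parallel edges).

cycleEdges : (k : ℕ) → List (Fin (suc k) × Fin (suc k))
cycleEdges k = map (λ i → (inject₁ i , suc i)) (allFin k) ++ ((fromℕ k , zero) ∷ [])

-- W̄_n with multiplicity a: hub p = vertex 0, rim p_{j+1} = vertex suc j.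
-- (Only meaningful for n ≥ 2; n = 0 gives a single vertex.)
Wbar : (a n : ℕ) → Graph
Wbar a zero    = record { V = 1 ; edges = [] }
Wbar a (suc k) = record
  { V     = suc (suc k)
  ; edges = map (λ p → (suc (proj₁ p) , suc (proj₂ p))) (cycleEdges k)
            ++ concatMap (λ j → replicate a (zero , suc j)) (allFin (suc k)) }

Wpoly : ℕ → ℤ → ℤ
Wpoly zero          x = + 1
Wpoly (suc zero)    x = x ℤ.+ + 4
Wpoly (suc (suc n)) x = (x ℤ.+ + 2) ℤ.* Wpoly (suc n) x ℤ.- Wpoly n x ℤ.+ + 2

Lucas : ℕ → ℕ
Lucas zero          = 2
Lucas (suc zero)    = 1
Lucas (suc (suc k)) = Lucas (suc k) + Lucas k

module Submission where

-- Cutting the rim edges that a spanning tree T of W̄ₙ omits splits the rim cycle into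
-- arcs: T omits at least one rim edge and joins each arc to the hub by exactly one
-- spoke, i.e. by one of the a parallel edges at exactly one vertex of the arc.  Read
-- once around the rim, T is therefore a cyclic word of cells (is the rim edge kept?
-- which spoke is kept?) accepted by an automaton whose state records whether the
-- current arc already has its spoke and whether some rim edge has been cut.  By the
-- transfer-matrix method, t + 2 is the trace of Mⁿ for M = [[1+a, a], [1, 1]] (the 2
-- counts the two cut-free cyclic words), so it satisfies u(m+2) = (a+2) u(m+1) − u(m),
-- the recurrence of a·W_{m−1}(a) + 2 and, for a = 1, of L_{2m}.

open import Defs
open import Axiom.UniquenessOfIdentityProofs.WithK using (uip)
open import Data.Bool using (Bool; true; false; _∨_; not; if_then_else_)
open import Data.Bool.Properties using (∨-assoc; ∨-identityʳ; ∨-zeroʳ; ∨-conicalˡ; ∨-conicalʳ; ¬-not)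
import Data.Bool.Properties as Bool
open import Data.Empty using (⊥; ⊥-elim)
open import Data.Fin using (Fin; zero; suc; toℕ; inject₁; fromℕ; _≟_)
open import Data.Fin.Properties
  using (toℕ-injective; toℕ-fromℕ<; toℕ-inject₁; toℕ-fromℕ; toℕ<n; +↔⊎; *↔×; any?; all?; ¬∀⟶∃¬)
open import Data.Fin.Relation.Unary.Top using (view; ‵fromℕ; ‵inj₁; view-fromℕ; view-inject₁)
open import Data.Fin.Subset using (Subset; _∈_)
open import Data.Integer as ℤ using (ℤ; +_)
open import Data.Integer.Properties using (pos-+; pos-*; +-injective)
import Data.Integer.Tactic.RingSolver as ℤ-Ring
import Data.Irrelevant as Irrelevant
open import Data.List using (List; []; _∷_; _++_; map; concatMap; replicate; length)
import Data.List as List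
open import Data.Maybe using (Maybe; just; nothing; is-just; _>>=_)
import Data.Maybe.Properties as Maybe
open import Data.Nat using (ℕ; zero; suc; _+_; _*_; _∸_; _≤_; _<_; _%_; _/_; z≤n; s≤s; s≤s⁻¹)
open import Data.Nat.DivMod
  using (_mod_; m%n<n; m%n≤n; m%n%n≡m%n; %-distribˡ-+; %-remove-+ʳ; m<n⇒m%n≡m; n%n≡0; m≡m%n+[m/n]*n; [m+n]%n≡m%n)
open import Data.Nat.Divisibility using (_∣_; divides)
open import Data.Nat.Properties
  using ( +-comm; +-suc; +-identityʳ; *-zeroʳ; *-identityʳ; m+[n∸m]≡n; m+n∸n≡m; m∸n+n≡m; m≤n+m; ≤-refl; ≤-trans
        ; <-trans; <-irrefl; <⇒≤; n≤1+n; m≤n⇒m<n∨m≡n; ≤∧≢⇒<; m≤n⇒m≤1+n)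
import Data.Nat.Properties
open import Algebra.Properties.CommutativeSemigroup Data.Nat.Properties.+-commutativeSemigroup
  using (xy∙z≈y∙xz; xy∙z≈x∙zy)
import Data.Nat.Tactic.RingSolver as ℕ-Ring
open import Data.Product using (Σ; Σ-syntax; ∃; _×_; _,_; proj₁; proj₂; uncurry; map₂)
open import Data.Product.Function.NonDependent.Propositional using (_×-↔_)
import Data.Product.Properties as Product
open import Data.Refinement using (_,_; value-injective)
open import Data.Sum using (_⊎_; inj₁; inj₂; [_,_]; [_,_]′)
open import Data.Sum.Function.Propositional using (_⊎-↔_)
open import Data.Vec using (Vec; []; _∷_; tabulate; lookup)
open import Data.Vec.Properties using ([]=⇒lookup; lookup⇒[]=; lookup∘tabulate; tabulate∘lookup; tabulate-cong)
import Data.Vec.Properties as Vec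
open import Function using (_∘_; id; const; case_of_)
open import Function.Bundles using (_↔_; Inverse; mk↔ₛ′)
open import Function.Properties.Inverse using (↔-refl; ↔-sym; ↔-trans)
open import Relation.Binary.PropositionalEquality
  using (_≡_; _≢_; refl; cong; cong₂; sym; trans; subst; subst₂; module ≡-Reasoning)
open import Relation.Nullary using (¬_; Dec; yes; no; does; Irrelevant; recompute)
open import Relation.Nullary.Decidable using (dec-true; dec-false)

true≢false : true ≢ false
true≢false ()

-- Enumerations of lists

record Enumeration {I A : Set} (f : I → A) (xs : List A) : Set where
  field
    positions       : I ↔ Fin (length xs)
    lookup-position : ∀ i → List.lookup xs (Inverse.to positions i) ≡ f i

open Enumeration

reindex : ∀ {I J A} {f : I → A} {g : J → A} {xs} (σ : J ↔ I) → (∀ j → f (Inverse.to σ j) ≡ g j) →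
  Enumeration f xs → Enumeration g xs
reindex σ f∘σ≗g e = record
  { positions       = ↔-trans σ (positions e)
  ; lookup-position = λ j → trans (lookup-position e (Inverse.to σ j)) (f∘σ≗g j) }

module _ {A : Set} where

  singletonₑ : (x : A) → Enumeration {Fin 1} (const x) (x ∷ [])
  singletonₑ x = record { positions = ↔-refl ; lookup-position = λ { zero → refl } }

  private
    inl : (xs ys : List A) → Fin (length xs) → Fin (length (xs ++ ys))
    inl (x ∷ xs) ys zero    = zero
    inl (x ∷ xs) ys (suc i) = suc (inl xs ys i)

    inr : (xs ys : List A) → Fin (length ys) → Fin (length (xs ++ ys))
    inr []       ys j = j
    inr (x ∷ xs) ys j = suc (inr xs ys j)

    join : (xs ys : List A) → Fin (length xs) ⊎ Fin (length ys) → Fin (length (xs ++ ys))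
    join xs ys = [ inl xs ys , inr xs ys ]

    split : (xs ys : List A) → Fin (length (xs ++ ys)) → Fin (length xs) ⊎ Fin (length ys)
    split []       ys p       = inj₂ p
    split (x ∷ xs) ys zero    = inj₁ zero
    split (x ∷ xs) ys (suc p) = [ inj₁ ∘ suc , inj₂ ] (split xs ys p)

    join-split : (xs ys : List A) (p : Fin (length (xs ++ ys))) → join xs ys (split xs ys p) ≡ p
    join-split []       ys p       = refl
    join-split (x ∷ xs) ys zero    = refl
    join-split (x ∷ xs) ys (suc p) with split xs ys p | join-split xs ys p
    ... | inj₁ i | eq = cong suc eq
    ... | inj₂ j | eq = cong suc eq

    split-join : (xs ys : List A) (q : Fin (length xs) ⊎ Fin (length ys)) → split xs ys (join xs ys q) ≡ q
    split-join (x ∷ xs) ys (inj₁ zero)    = refl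
    split-join (x ∷ xs) ys (inj₁ (suc i)) rewrite split-join xs ys (inj₁ i) = refl
    split-join []       ys (inj₂ j)       = refl
    split-join (x ∷ xs) ys (inj₂ j)       rewrite split-join xs ys (inj₂ j) = refl

  ++-positions : (xs ys : List A) → (Fin (length xs) ⊎ Fin (length ys)) ↔ Fin (length (xs ++ ys))
  ++-positions xs ys = mk↔ₛ′ (join xs ys) (split xs ys) (join-split xs ys) (split-join xs ys)

  lookup-++-positions : (xs ys : List A) (q : Fin (length xs) ⊎ Fin (length ys)) →
    List.lookup (xs ++ ys) (Inverse.to (++-positions xs ys) q) ≡ [ List.lookup xs , List.lookup ys ] q
  lookup-++-positions (x ∷ xs) ys (inj₁ zero)    = refl
  lookup-++-positions (x ∷ xs) ys (inj₁ (suc i)) = lookup-++-positions xs ys (inj₁ i)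
  lookup-++-positions []       ys (inj₂ j)       = refl
  lookup-++-positions (x ∷ xs) ys (inj₂ j)       = lookup-++-positions xs ys (inj₂ j)

  map-positions : {B : Set} (h : A → B) (xs : List A) → Fin (length xs) ↔ Fin (length (map h xs))
  map-positions h xs = mk↔ₛ′ (to xs) (from xs) (to-from xs) (from-to xs)
    where
    to : ∀ xs → Fin (length xs) → Fin (length (map h xs))
    to (x ∷ xs) zero    = zero
    to (x ∷ xs) (suc p) = suc (to xs p)
    from : ∀ xs → Fin (length (map h xs)) → Fin (length xs)
    from (x ∷ xs) zero    = zero
    from (x ∷ xs) (suc p) = suc (from xs p)
    to-from : ∀ xs p → to xs (from xs p) ≡ p
    to-from (x ∷ xs) zero    = refl
    to-from (x ∷ xs) (suc p) = cong suc (to-from xs p)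
    from-to : ∀ xs p → from xs (to xs p) ≡ p
    from-to (x ∷ xs) zero    = refl
    from-to (x ∷ xs) (suc p) = cong suc (from-to xs p)

  lookup-map-positions : {B : Set} (h : A → B) (xs : List A) (p : Fin (length xs)) →
    List.lookup (map h xs) (Inverse.to (map-positions h xs) p) ≡ h (List.lookup xs p)
  lookup-map-positions h (x ∷ xs) zero    = refl
  lookup-map-positions h (x ∷ xs) (suc p) = lookup-map-positions h xs p

_++ₑ_ : ∀ {I J A} {f : I → A} {g : J → A} {xs ys} → Enumeration f xs → Enumeration g ys → Enumeration [ f , g ] (xs ++ ys)
_++ₑ_ {xs = xs} {ys} ex ey = record
  { positions       = ↔-trans (positions ex ⊎-↔ positions ey) (++-positions xs ys)
  ; lookup-position = λ
    { (inj₁ i) → trans (lookup-++-positions xs ys (inj₁ _)) (lookup-position ex i)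
    ; (inj₂ j) → trans (lookup-++-positions xs ys (inj₂ _)) (lookup-position ey j) } }

mapₑ : ∀ {I A B} {f : I → A} {xs} (h : A → B) → Enumeration f xs → Enumeration (h ∘ f) (map h xs)
mapₑ {xs = xs} h e = record
  { positions       = ↔-trans (positions e) (map-positions h xs)
  ; lookup-position = λ i → trans (lookup-map-positions h xs _) (cong h (lookup-position e i)) }

tabulateₑ : ∀ {A m} (h : Fin m → A) → Enumeration h (List.tabulate h)
tabulateₑ {m = zero}  h = record { positions = ↔-refl ; lookup-position = λ () }
tabulateₑ {m = suc m} h =
  reindex (+↔⊎ {1}) (λ { zero → refl ; (suc i) → refl }) (singletonₑ (h zero) ++ₑ tabulateₑ (h ∘ suc))

replicateₑ : ∀ {A} m (x : A) → Enumeration {Fin m} (const x) (replicate m x)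
replicateₑ zero    x = record { positions = ↔-refl ; lookup-position = λ () }
replicateₑ (suc m) x =
  reindex (+↔⊎ {1}) (λ { zero → refl ; (suc i) → refl }) (singletonₑ x ++ₑ replicateₑ m x)

concatMap-tabulateₑ : ∀ {B J C : Set} {g : B → List C} {φ : B → J → C} → (∀ b → Enumeration (φ b) (g b)) →
  ∀ {m} (h : Fin m → B) → Enumeration (uncurry (φ ∘ h)) (concatMap g (List.tabulate h))
concatMap-tabulateₑ e {zero}  h = record
  { positions = mk↔ₛ′ (λ { (() , _) }) (λ ()) (λ ()) (λ { (() , _) }) ; lookup-position = λ { (() , _) } }
concatMap-tabulateₑ {J = J} e {suc m} h =
  reindex first-or-rest (λ { (zero , j) → refl ; (suc i , j) → refl }) (e (h zero) ++ₑ concatMap-tabulateₑ e (h ∘ suc))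
  where
  first-or-rest : (Fin (suc m) × J) ↔ (J ⊎ (Fin m × J))
  first-or-rest = mk↔ₛ′ (λ { (zero , j) → inj₁ j ; (suc i , j) → inj₂ (i , j) })
                        [ (λ j → zero , j) , (λ { (i , j) → suc i , j }) ]
                        (λ { (inj₁ j) → refl ; (inj₂ (i , j)) → refl })
                        (λ { (zero , j) → refl ; (suc i , j) → refl })

-- The cyclic order of the rim

next : ∀ {k} → Fin (suc k) → Fin (suc k)
next i with view i
... | ‵fromℕ          = zero
... | ‵inj₁ {i = j} _ = suc j

next-fromℕ : ∀ k → next (fromℕ k) ≡ zero
next-fromℕ k rewrite view-fromℕ k = refl

next-inject₁ : ∀ {k} (j : Fin k) → next (inject₁ j) ≡ suc j
next-inject₁ j rewrite view-inject₁ j = refl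

module Modular (k : ℕ) where

  n : ℕ
  n = suc k

  toℕ-mod : ∀ i → toℕ (i mod n) ≡ i % n
  toℕ-mod i = toℕ-fromℕ< (m%n<n i n)

  mod-toℕ : ∀ (v : Fin n) → toℕ v mod n ≡ v
  mod-toℕ v = toℕ-injective (trans (toℕ-mod (toℕ v)) (m<n⇒m%n≡m (toℕ<n v)))

  %-absorbˡ : ∀ i j → (i % n + j) % n ≡ (i + j) % n
  %-absorbˡ i j = begin
    (i % n + j) % n          ≡⟨ %-distribˡ-+ (i % n) j n ⟩
    (i % n % n + j % n) % n  ≡⟨ cong (λ x → (x + j % n) % n) (m%n%n≡m%n i n) ⟩
    (i % n + j % n) % n      ≡⟨ %-distribˡ-+ i j n ⟨
    (i + j) % n              ∎
    where open ≡-Reasoning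

  toℕ-next : ∀ v → toℕ (next v) ≡ suc (toℕ v) % n
  toℕ-next v with view v
  ... | ‵fromℕ          = sym (trans (cong (λ x → suc x % n) (toℕ-fromℕ k)) (n%n≡0 n))
  ... | ‵inj₁ {i = j} _ = sym (trans (cong (λ x → suc x % n) (toℕ-inject₁ j)) (m<n⇒m%n≡m (s≤s (toℕ<n j))))

  next-mod : ∀ i → next (i mod n) ≡ suc i mod n
  next-mod i = toℕ-injective (begin
    toℕ (next (i mod n))     ≡⟨ toℕ-next (i mod n) ⟩
    suc (toℕ (i mod n)) % n  ≡⟨ cong (λ x → suc x % n) (toℕ-mod i) ⟩
    (1 + i % n) % n          ≡⟨ cong (_% n) (+-comm 1 (i % n)) ⟩
    (i % n + 1) % n          ≡⟨ %-absorbˡ i 1 ⟩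
    (i + 1) % n              ≡⟨ cong (_% n) (+-comm i 1) ⟩
    suc i % n                ≡⟨ toℕ-mod (suc i) ⟨
    toℕ (suc i mod n)        ∎)
    where open ≡-Reasoning

  +n-mod : ∀ i → (i + n) mod n ≡ i mod n
  +n-mod i = toℕ-injective (trans (toℕ-mod (i + n)) (trans ([m+n]%n≡m%n i n) (sym (toℕ-mod i))))

  module Rotation (b : ℕ) where

    at : ℕ → Fin n
    at i = (b + i) mod n

    next-at : ∀ i → next (at i) ≡ at (suc i)
    next-at i = trans (next-mod (b + i)) (cong (_mod n) (sym (+-suc b i)))

    at-periodic : at n ≡ at 0
    at-periodic = trans (+n-mod b) (cong (_mod n) (sym (+-identityʳ b)))

    private
      shift : ℕ
      shift = n ∸ b % n

      n∣b+shift : n ∣ b + shift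
      n∣b+shift = divides (suc (b / n)) (begin
        b + shift                    ≡⟨ cong (_+ shift) (m≡m%n+[m/n]*n b n) ⟩
        b % n + b / n * n + shift    ≡⟨ xy∙z≈y∙xz (b % n) (b / n * n) shift ⟩
        b / n * n + (b % n + shift)  ≡⟨ cong (λ x → b / n * n + x) (m+[n∸m]≡n (m%n≤n b n)) ⟩
        b / n * n + n                ≡⟨ +-comm (b / n * n) n ⟩
        suc (b / n) * n              ∎)
        where open ≡-Reasoning

    positionOf : Fin n → ℕ
    positionOf v = (toℕ v + shift) % n

    positionOf<n : ∀ v → positionOf v < n
    positionOf<n v = m%n<n (toℕ v + shift) n

    positionOf-at : ∀ i → positionOf (at i) ≡ i % n
    positionOf-at i = begin
      (toℕ (at i) + shift) % n   ≡⟨ cong (λ x → (x + shift) % n) (toℕ-mod (b + i)) ⟩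
      ((b + i) % n + shift) % n  ≡⟨ %-absorbˡ (b + i) shift ⟩
      (b + i + shift) % n        ≡⟨ cong (_% n) (xy∙z≈y∙xz b i shift) ⟩
      (i + (b + shift)) % n      ≡⟨ %-remove-+ʳ i n∣b+shift ⟩
      i % n                      ∎
      where open ≡-Reasoning

    positionOf-at< : ∀ {i} → i < n → positionOf (at i) ≡ i
    positionOf-at< {i} i<n = trans (positionOf-at i) (m<n⇒m%n≡m i<n)

    at-positionOf : ∀ v → at (positionOf v) ≡ v
    at-positionOf v = toℕ-injective (begin
      toℕ (at (positionOf v))        ≡⟨ toℕ-mod (b + positionOf v) ⟩
      (b + (toℕ v + shift) % n) % n  ≡⟨ cong (_% n) (+-comm b _) ⟩
      ((toℕ v + shift) % n + b) % n  ≡⟨ %-absorbˡ (toℕ v + shift) b ⟩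
      (toℕ v + shift + b) % n        ≡⟨ cong (_% n) (xy∙z≈x∙zy (toℕ v) shift b) ⟩
      (toℕ v + (b + shift)) % n      ≡⟨ %-remove-+ʳ (toℕ v) n∣b+shift ⟩
      toℕ v % n                      ≡⟨ m<n⇒m%n≡m (toℕ<n v) ⟩
      toℕ v                          ∎)
      where open ≡-Reasoning

    at-injective : ∀ {i j} → i < n → j < n → at i ≡ at j → i ≡ j
    at-injective i<n j<n eq = trans (sym (positionOf-at< i<n)) (trans (cong positionOf eq) (positionOf-at< j<n))

  module RotationAfter (v : Fin n) where

    open Rotation (suc (toℕ v)) public

    at-last : at k ≡ v
    at-last = trans (cong (_mod n) (sym (+-suc (toℕ v) k))) (trans (+n-mod (toℕ v)) (mod-toℕ v))

    at-first : at 0 ≡ next v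
    at-first = trans (cong (_mod n) (+-identityʳ (suc (toℕ v)))) (trans (sym (next-mod (toℕ v))) (cong next (mod-toℕ v)))

-- The edges of the wheel

inject₁-or-last : ∀ {k} → Fin (suc k) ↔ (Fin k ⊎ Fin 1)
inject₁-or-last {k} = mk↔ₛ′ to [ inject₁ , (λ _ → fromℕ k) ] to-from from-to
  where
  to : Fin (suc k) → Fin k ⊎ Fin 1
  to i with view i
  ... | ‵fromℕ          = inj₂ zero
  ... | ‵inj₁ {i = j} _ = inj₁ j
  to-from : ∀ q → to ([ inject₁ , (λ _ → fromℕ k) ] q) ≡ q
  to-from (inj₁ j)    rewrite view-inject₁ j = refl
  to-from (inj₂ zero) rewrite view-fromℕ k   = refl
  from-to : ∀ i → [ inject₁ , (λ _ → fromℕ k) ] (to i) ≡ i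
  from-to i with view i
  ... | ‵fromℕ  = refl
  ... | ‵inj₁ _ = refl

cycleₑ : ∀ k → Enumeration (λ (v : Fin (suc k)) → (v , next v)) (cycleEdges k)
cycleₑ k = reindex inject₁-or-last endpoints
  (mapₑ (λ i → (inject₁ i , suc i)) (tabulateₑ id) ++ₑ singletonₑ (fromℕ k , zero))
  where
  endpoints : ∀ v → [ (λ i → inject₁ i , suc i) , const (fromℕ k , zero) ]′ (Inverse.to inject₁-or-last v) ≡ (v , next v)
  endpoints v with view v
  ... | ‵fromℕ          = cong (fromℕ k ,_) (sym (next-fromℕ k))
  ... | ‵inj₁ {i = j} _ = cong (inject₁ j ,_) (sym (next-inject₁ j))

WheelEdge : ℕ → ℕ → Set
WheelEdge n a = Fin n ⊎ (Fin n × Fin a)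

pattern rim v     = inj₁ v
pattern spoke v c = inj₂ (v , c)

vertex : ∀ {n a} → WheelEdge n a → Fin n
vertex (rim v)     = v
vertex (spoke v _) = v

ends : ∀ {k a} → WheelEdge (suc k) a → Fin (suc (suc k)) × Fin (suc (suc k))
ends (rim v)     = suc v , suc (next v)
ends (spoke v c) = zero , suc v

source target : ∀ {k a} → WheelEdge (suc k) a → Fin (suc (suc k))
source = proj₁ ∘ ends
target = proj₂ ∘ ends

wheelₑ : ∀ a k → Enumeration ends (edges (Wbar a (suc k)))
wheelₑ a k = reindex ↔-refl (λ { (rim v) → refl ; (spoke v c) → refl })
  (mapₑ (λ p → (suc (proj₁ p) , suc (proj₂ p))) (cycleₑ k)
   ++ₑ concatMap-tabulateₑ (λ j → replicateₑ a (zero , suc j)) id)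

-- Reachability

module _ {G : Graph} where

  reach-trans : ∀ {P u v w} → Reach G P u v → Reach G P v w → Reach G P u w
  reach-trans here        q = q
  reach-trans (fwd e p r) q = fwd e p (reach-trans r q)
  reach-trans (bwd e p r) q = bwd e p (reach-trans r q)

  reach-sym : ∀ {P u v} → Reach G P u v → Reach G P v u
  reach-sym here        = here
  reach-sym (fwd e p r) = reach-trans (reach-sym r) (bwd e p here)
  reach-sym (bwd e p r) = reach-trans (reach-sym r) (fwd e p here)

Closed : (G : Graph) → (Fin (E G) → Set) → (Fin (V G) → Set) → Set
Closed G P Q = ∀ e → P e → (Q (src G e) → Q (tgt G e)) × (Q (tgt G e) → Q (src G e))

reach-closed : ∀ {G P} (Q : Fin (V G) → Set) → Closed G P Q → ∀ {u v} → Reach G P u v → Q u → Q v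
reach-closed Q closed here        q = q
reach-closed Q closed (fwd e p r) q = reach-closed Q closed r (proj₁ (closed e p) q)
reach-closed Q closed (bwd e p r) q = reach-closed Q closed r (proj₂ (closed e p) q)

-- The transfer automaton

-- A cell describes a rim vertex v: whether the rim edge from v to next v is kept, and which
-- spoke at v (if any) is kept.  In Law s x s′, the flag s (resp. s′) says that the arc of v
-- (resp. of next v) already has its spoke at an earlier vertex.
Cell : ℕ → Set
Cell a = Bool × Maybe (Fin a)

record Law {a} (s : Bool) (x : Cell a) (s′ : Bool) : Set where
  field
    unseen-at-spoke : is-just (proj₂ x) ≡ true → s ≡ false
    carried         : proj₁ x ≡ true → s′ ≡ s ∨ is-just (proj₂ x)
    covered-at-cut  : proj₁ x ≡ false → s ∨ is-just (proj₂ x) ≡ true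
    reset-at-cut    : proj₁ x ≡ false → s′ ≡ false

-- The flag s of Law, and whether a rim edge has been cut so far.
State : Set
State = Bool × Bool

step : ∀ {a} → State → Cell a → Maybe State
step (false , f) (true  , nothing) = just (false , f)
step (false , f) (true  , just _)  = just (true , f)
step (false , f) (false , nothing) = nothing
step (false , f) (false , just _)  = just (false , true)
step (true  , f) (true  , nothing) = just (true , f)
step (true  , f) (false , nothing) = just (false , true)
step (true  , f) (_     , just _)  = nothing

run : ∀ {a m} → State → Vec (Cell a) m → Maybe State
run σ []       = just σ
run σ (x ∷ xs) = step σ x >>= λ τ → run τ xs

step⇒law : ∀ {a} s f (x : Cell a) {s′ f′} → step (s , f) x ≡ just (s′ , f′) → Law s x s′ × f′ ≡ f ∨ not (proj₁ x)
step⇒law false f (true  , nothing) refl =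
  record { unseen-at-spoke = λ () ; carried = λ _ → refl ; covered-at-cut = λ () ; reset-at-cut = λ () } , sym (∨-identityʳ f)
step⇒law false f (true  , just _)  refl =
  record { unseen-at-spoke = λ _ → refl ; carried = λ _ → refl ; covered-at-cut = λ () ; reset-at-cut = λ () } , sym (∨-identityʳ f)
step⇒law false f (false , just _)  refl =
  record { unseen-at-spoke = λ _ → refl ; carried = λ () ; covered-at-cut = λ _ → refl ; reset-at-cut = λ _ → refl } , sym (∨-zeroʳ f)
step⇒law true  f (true  , nothing) refl =
  record { unseen-at-spoke = λ () ; carried = λ _ → refl ; covered-at-cut = λ () ; reset-at-cut = λ () } , sym (∨-identityʳ f)
step⇒law true  f (false , nothing) refl =
  record { unseen-at-spoke = λ () ; carried = λ () ; covered-at-cut = λ _ → refl ; reset-at-cut = λ _ → refl } , sym (∨-zeroʳ f)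

law⇒step : ∀ {a} s f (x : Cell a) {s′} → Law s x s′ → step (s , f) x ≡ just (s′ , f ∨ not (proj₁ x))
law⇒step false f (true  , nothing) law rewrite Law.carried law refl | ∨-identityʳ f = refl
law⇒step false f (true  , just _)  law rewrite Law.carried law refl | ∨-identityʳ f = refl
law⇒step false f (false , nothing) law with Law.covered-at-cut law refl
... | ()
law⇒step false f (false , just _)  law rewrite Law.reset-at-cut law refl | ∨-zeroʳ f = refl
law⇒step true  f (true  , nothing) law rewrite Law.carried law refl | ∨-identityʳ f = refl
law⇒step true  f (false , nothing) law rewrite Law.reset-at-cut law refl | ∨-zeroʳ f = refl
law⇒step true  f (_     , just _)  law with Law.unseen-at-spoke law refl
... | ()

anyCut : ∀ {a m} → (Fin m → Cell a) → Bool
anyCut {m = zero}  c = false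
anyCut {m = suc m} c = not (proj₁ (c zero)) ∨ anyCut (c ∘ suc)

anyCut⇒cut : ∀ {a m} (c : Fin m → Cell a) → anyCut c ≡ true → ∃ λ i → proj₁ (c i) ≡ false
anyCut⇒cut {m = suc m} c any with proj₁ (c zero) in c₀
... | false = zero , c₀
... | true  with anyCut⇒cut (c ∘ suc) any
...   | i , cᵢ = suc i , cᵢ

cut⇒anyCut : ∀ {a m} (c : Fin m → Cell a) i → proj₁ (c i) ≡ false → anyCut c ≡ true
cut⇒anyCut c zero    cᵢ rewrite cᵢ = refl
cut⇒anyCut c (suc i) cᵢ rewrite cut⇒anyCut (c ∘ suc) i cᵢ = ∨-zeroʳ _

Laws : ∀ {a m} → (Fin (suc m) → Bool) → (Fin m → Cell a) → Set
Laws sq c = ∀ i → Law (sq (inject₁ i)) (c i) (sq (suc i))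

laws⇒run : ∀ {a m} (sq : Fin (suc m) → Bool) (c : Fin m → Cell a) f → Laws sq c →
  run (sq zero , f) (tabulate c) ≡ just (sq (fromℕ m) , f ∨ anyCut c)
laws⇒run {m = zero}  sq c f laws = cong (λ f′ → just (sq zero , f′)) (sym (∨-identityʳ f))
laws⇒run {m = suc m} sq c f laws rewrite law⇒step (sq zero) f (c zero) (laws zero) =
  trans (laws⇒run (sq ∘ suc) (c ∘ suc) _ (laws ∘ suc)) (cong (λ f′ → just (sq (fromℕ (suc m)) , f′)) (∨-assoc f _ _))

run⇒laws : ∀ {a m} (c : Fin m → Cell a) s₀ f {s₁ f₁} → run (s₀ , f) (tabulate c) ≡ just (s₁ , f₁) →
  Σ (Fin (suc m) → Bool) λ sq → sq zero ≡ s₀ × sq (fromℕ m) ≡ s₁ × Laws sq c × f₁ ≡ f ∨ anyCut c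
run⇒laws {m = zero}  c s₀ f refl = (λ _ → s₀) , refl , refl , (λ ()) , sym (∨-identityʳ f)
run⇒laws {m = suc m} c s₀ f r with step (s₀ , f) (c zero) in first
... | just (s , f′) with step⇒law s₀ f (c zero) first | run⇒laws (c ∘ suc) s f′ r
...   | law₀ , refl | sq , refl , last , laws , flag = sq′ , refl , last , laws′ , trans flag (∨-assoc f _ _)
  where
  sq′ : Fin (suc (suc m)) → Bool
  sq′ zero    = s₀
  sq′ (suc i) = sq i
  laws′ : Laws sq′ c
  laws′ zero    = law₀
  laws′ (suc i) = laws i

CyclicRun : ∀ {a m} → Vec (Cell a) m → Set
CyclicRun w = Σ Bool λ s → run (s , false) w ≡ just (s , true)

just-seen-injective : ∀ {t₁ t₂ : Bool} {f : Bool} → just (t₁ , f) ≡ just (t₂ , f) → t₁ ≡ t₂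
just-seen-injective refl = refl

cut-runs-converge : ∀ {a m} (w : Vec (Cell a) m) s₁ s₂ {t₁ t₂} →
  run (s₁ , false) w ≡ just (t₁ , true) → run (s₂ , false) w ≡ just (t₂ , true) → t₁ ≡ t₂
cut-runs-converge w                       false false p q  = just-seen-injective (trans (sym p) q)
cut-runs-converge w                       true  true  p q  = just-seen-injective (trans (sym p) q)
cut-runs-converge ((true , nothing) ∷ w)  false true  p q  = cut-runs-converge w false true p q
cut-runs-converge ((true , nothing) ∷ w)  true  false p q  = cut-runs-converge w true false p q
cut-runs-converge ((true , just _) ∷ w)   false true  p ()
cut-runs-converge ((true , just _) ∷ w)   true  false () q
cut-runs-converge ((false , nothing) ∷ w) false true  () q
cut-runs-converge ((false , nothing) ∷ w) true  false p ()
cut-runs-converge ((false , just _) ∷ w)  false true  p ()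
cut-runs-converge ((false , just _) ∷ w)  true  false () q
cut-runs-converge []                      false true  () q
cut-runs-converge []                      true  false () q

module _ {a k : ℕ} (c : Fin (suc k) → Cell a) where

  open Modular k

  CyclicLaw : Set
  CyclicLaw = Σ (Fin n → Bool) λ seen → ∀ v → Law (seen v) (c v) (seen (next v))

  HasCut : Set
  HasCut = ∃ λ v → proj₁ (c v) ≡ false

  cyclicRun⇒law : CyclicRun (tabulate c) → CyclicLaw × HasCut
  cyclicRun⇒law (s , r) with run⇒laws c s false r
  ... | sq , first , last , laws , flag = (sq ∘ inject₁ , law) , anyCut⇒cut c (sym flag)
    where
    wrap : ∀ v → sq (suc v) ≡ sq (inject₁ (next v))
    wrap v with view v
    ... | ‵fromℕ  = trans last (sym first)
    ... | ‵inj₁ _ = refl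
    law : ∀ v → Law (sq (inject₁ v)) (c v) (sq (inject₁ (next v)))
    law v = subst (Law (sq (inject₁ v)) (c v)) (wrap v) (laws v)

  law⇒cyclicRun : CyclicLaw × HasCut → CyclicRun (tabulate c)
  law⇒cyclicRun ((seen , law) , v , cut) =
    sq zero , trans (laws⇒run sq c false laws) (cong₂ (λ s f → just (s , f)) periodic (cut⇒anyCut c v cut))
    where
    sq : Fin (suc n) → Bool
    sq j = seen (toℕ j mod n)
    laws : Laws sq c
    laws i = subst₂ (λ s s′ → Law s (c i) s′)
      (cong seen (sym (trans (cong (_mod n) (toℕ-inject₁ i)) (mod-toℕ i))))
      (cong seen (trans (cong next (sym (mod-toℕ i))) (next-mod (toℕ i))))
      (law i)
    periodic : sq (fromℕ n) ≡ sq zero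
    periodic = cong seen (trans (cong (_mod n) (toℕ-fromℕ n)) (+n-mod 0))

_≟ₘ_ : (x y : Maybe State) → Dec (x ≡ y)
_≟ₘ_ = Maybe.≡-dec (Product.≡-dec Bool._≟_ Bool._≟_)

cyclicRun? : ∀ {a m} (w : Vec (Cell a) m) → Dec (CyclicRun w)
cyclicRun? w with run (false , false) w ≟ₘ just (false , true) | run (true , false) w ≟ₘ just (true , true)
... | yes p | _     = yes (false , p)
... | no _  | yes q = yes (true , q)
... | no ¬p | no ¬q = no λ { (false , p) → ¬p p ; (true , q) → ¬q q }

cyclicRun-irrelevant : ∀ {a m} (w : Vec (Cell a) m) → Irrelevant (CyclicRun w)
cyclicRun-irrelevant w (s₁ , p) (s₂ , q) with cut-runs-converge w s₁ s₂ p q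
... | refl = cong (s₁ ,_) (uip p q)

-- Spanning trees of the wheel

isChoice : ∀ {a} → Maybe (Fin a) → Fin a → Bool
isChoice nothing   c = false
isChoice (just c′) c = does (c′ ≟ c)

isChoice-true : ∀ {a} (m : Maybe (Fin a)) c → isChoice m c ≡ true → m ≡ just c
isChoice-true (just c′) c eq with c′ ≟ c | eq
... | yes refl | _ = refl
... | no _     | ()

isChoice-just : ∀ {a} (c : Fin a) → isChoice (just c) c ≡ true
isChoice-just c = dec-true (c ≟ c) refl

module Wheel (a k : ℕ) where

  n : ℕ
  n = suc k

  G : Graph
  G = Wbar a n

  private
    module Edges = Inverse (positions (wheelₑ a k))

  edge : WheelEdge n a → Fin (E G)
  edge = Edges.to

  kind : Fin (E G) → WheelEdge n a
  kind = Edges.from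

  kind-edge : ∀ x → kind (edge x) ≡ x
  kind-edge = Edges.strictlyInverseʳ

  edge-kind : ∀ e → edge (kind e) ≡ e
  edge-kind = Edges.strictlyInverseˡ

  edge-injective : ∀ {x y} → edge x ≡ edge y → x ≡ y
  edge-injective {x} {y} eq = trans (sym (kind-edge x)) (trans (cong kind eq) (kind-edge y))

  src-edge : ∀ x → src G (edge x) ≡ source x
  src-edge x = cong proj₁ (lookup-position (wheelₑ a k) x)

  tgt-edge : ∀ x → tgt G (edge x) ≡ target x
  tgt-edge x = cong proj₂ (lookup-position (wheelₑ a k) x)

  module _ {P : Fin (E G) → Set} where

    forward : ∀ x {w} → P (edge x) → Reach G P (target x) w → Reach G P (source x) w
    forward x p = subst₂ (λ u v → Reach G P v _ → Reach G P u _) (src-edge x) (tgt-edge x) (fwd (edge x) p)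

    backward : ∀ x {w} → P (edge x) → Reach G P (source x) w → Reach G P (target x) w
    backward x p = subst₂ (λ u v → Reach G P u _ → Reach G P v _) (src-edge x) (tgt-edge x) (bwd (edge x) p)

    closed-by-kind : (Q : Fin (V G) → Set) →
      (∀ x → P (edge x) → (Q (source x) → Q (target x)) × (Q (target x) → Q (source x))) → Closed G P Q
    closed-by-kind Q closed e = subst (λ e → P e → (Q (src G e) → Q (tgt G e)) × (Q (tgt G e) → Q (src G e)))
                                      (edge-kind e) (closed′ (kind e))
      where
      closed′ : ∀ x → P (edge x) → (Q (src G (edge x)) → Q (tgt G (edge x))) × (Q (tgt G (edge x)) → Q (src G (edge x)))
      closed′ x rewrite src-edge x | tgt-edge x = closed x

  module Subgraph (S : Subset (E G)) where

    Without : Fin (E G) → Fin (E G) → Set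
    Without e f = f ∈ S × f ≢ e

    NoCycleThrough : WheelEdge n a → Set
    NoCycleThrough x = edge x ∈ S → ¬ Reach G (Without (edge x)) (source x) (target x)

    acyclic-by-kind : (∀ x → NoCycleThrough x) → Acyclic G S
    acyclic-by-kind no-cycle e = subst (λ e → e ∈ S → ¬ Reach G (Without e) (src G e) (tgt G e)) (edge-kind e)
      (λ e∈S r → no-cycle (kind e) e∈S (subst₂ (Reach G _) (src-edge (kind e)) (tgt-edge (kind e)) r))

    no-cycle-through : Acyclic G S → ∀ x → NoCycleThrough x
    no-cycle-through acyclic x e∈S r = acyclic (edge x) e∈S (subst₂ (Reach G _) (sym (src-edge x)) (sym (tgt-edge x)) r)

    kept : Fin n → Bool
    kept v = lookup S (edge (rim v))

    spokeIn : Fin n → Fin a → Bool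
    spokeIn v c = lookup S (edge (spoke v c))

    kept⇒∈ : ∀ v → kept v ≡ true → edge (rim v) ∈ S
    kept⇒∈ v = lookup⇒[]= (edge (rim v)) S

    spokeIn⇒∈ : ∀ v c → spokeIn v c ≡ true → edge (spoke v c) ∈ S
    spokeIn⇒∈ v c = lookup⇒[]= (edge (spoke v c)) S

    chosen : Fin n → Maybe (Fin a)
    chosen v with any? (λ c → Bool._≟_ (spokeIn v c) true)
    ... | yes (c , _) = just c
    ... | no _        = nothing

    hasSpoke : Fin n → Bool
    hasSpoke v = is-just (chosen v)

    AtMostOneSpoke : Set
    AtMostOneSpoke = ∀ v c c′ → spokeIn v c ≡ true → spokeIn v c′ ≡ true → c ≡ c′

    chosen-spoke : ∀ v {c} → chosen v ≡ just c → spokeIn v c ≡ true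
    chosen-spoke v eq with any? (λ c → Bool._≟_ (spokeIn v c) true)
    chosen-spoke v refl | yes (c , p) = p

    hasSpoke-intro : ∀ v c → spokeIn v c ≡ true → hasSpoke v ≡ true
    hasSpoke-intro v c p with any? (λ c → Bool._≟_ (spokeIn v c) true)
    ... | yes _ = refl
    ... | no ¬c = ⊥-elim (¬c (c , p))

    hasSpoke-elim : ∀ v → hasSpoke v ≡ true → ∃ λ c → spokeIn v c ≡ true
    hasSpoke-elim v h with any? (λ c → Bool._≟_ (spokeIn v c) true)
    ... | yes p = p

    chosen-spec : ∀ v m → (∀ c → spokeIn v c ≡ isChoice m c) → chosen v ≡ m
    chosen-spec v m spec with any? (λ c → Bool._≟_ (spokeIn v c) true)
    ... | yes (c , p) = sym (isChoice-true m c (trans (sym (spec c)) p))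
    chosen-spec v nothing  spec | no _  = refl
    chosen-spec v (just c) spec | no ¬c = ⊥-elim (¬c (c , trans (spec c) (isChoice-just c)))

    isChoice-chosen : AtMostOneSpoke → ∀ v c → isChoice (chosen v) c ≡ spokeIn v c
    isChoice-chosen one-spoke v c with spokeIn v c in p | chosen v in ch
    ... | true  | just c′ = trans (cong (isChoice (just c′)) (sym (one-spoke v c′ c (chosen-spoke v ch) p))) (isChoice-just c′)
    ... | true  | nothing = ⊥-elim (true≢false (trans (sym (hasSpoke-intro v c p)) (cong is-just ch)))
    ... | false | nothing = refl
    ... | false | just c′ = dec-false (c′ ≟ c) λ { refl → true≢false (trans (sym (chosen-spoke v ch)) p) }

    cellOf : Fin n → Cell a
    cellOf v = kept v , chosen v

    module Arcs (b : ℕ) where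

      open Modular.Rotation k b public

      KeptBetween : ℕ → ℕ → Set
      KeptBetween j i = ∀ l → j ≤ l → l < i → kept (at l) ≡ true

      kb-empty : ∀ {i} → KeptBetween i i
      kb-empty l i≤l l<i = ⊥-elim (<-irrefl refl (≤-trans l<i i≤l))

      kb-shrinkˡ : ∀ {j i} → KeptBetween j i → KeptBetween (suc j) i
      kb-shrinkˡ kb l sj≤l = kb l (≤-trans (n≤1+n _) sj≤l)

      kb-shrinkʳ : ∀ {j i} → KeptBetween j (suc i) → KeptBetween j i
      kb-shrinkʳ kb l j≤l l<i = kb l j≤l (m≤n⇒m≤1+n l<i)

      kb-extendˡ : ∀ {j i} → kept (at j) ≡ true → KeptBetween (suc j) i → KeptBetween j i
      kb-extendˡ kj kb l j≤l with m≤n⇒m<n∨m≡n j≤l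
      ... | inj₁ j<l  = kb l j<l
      ... | inj₂ refl = λ _ → kj

      kb-extendʳ : ∀ {j i} → kept (at i) ≡ true → KeptBetween j i → KeptBetween j (suc i)
      kb-extendʳ ki kb l j≤l l<1+i with m≤n⇒m<n∨m≡n (s≤s⁻¹ l<1+i)
      ... | inj₁ l<i  = kb l j≤l l<i
      ... | inj₂ refl = ki

      rim-step : ∀ {P w} l → P (edge (rim (at l))) → Reach G P (suc (at (suc l))) w → Reach G P (suc (at l)) w
      rim-step {P} l p r = forward (rim (at l)) p (subst (λ v → Reach G P (suc v) _) (sym (next-at l)) r)

      rim-back : ∀ {P w} l → P (edge (rim (at l))) → Reach G P (suc (at l)) w → Reach G P (suc (at (suc l))) w
      rim-back l p r = reach-trans (reach-sym (rim-step l p here)) r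

      rim-walk : ∀ {P j i} → j ≤ i → (∀ l → j ≤ l → l < i → P (edge (rim (at l)))) → Reach G P (suc (at j)) (suc (at i))
      rim-walk j≤i ok with m≤n⇒m<n∨m≡n j≤i
      ... | inj₂ refl         = here
      ... | inj₁ (s≤s j≤i′) =
        reach-trans (rim-walk j≤i′ (λ l j≤l l<i′ → ok l j≤l (m≤n⇒m≤1+n l<i′))) (rim-step _ (ok _ j≤i′ ≤-refl) here)

      -- Cycles through an edge, and disconnections, are ruled out by exhibiting a set of rim vertices,
      -- given by positions, that is closed under the remaining edges and contains just one of the two ends.
      OnRim : (ℕ → Set) → Fin (V G) → Set
      OnRim C zero    = ⊥
      OnRim C (suc w) = C (positionOf w)

      onRim-elim : ∀ {C j} → j < n → OnRim C (suc (at j)) → C j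
      onRim-elim {C} j<n = subst C (positionOf-at< j<n)

      onRim-intro : ∀ {C j} → j < n → C j → OnRim C (suc (at j))
      onRim-intro {C} j<n = subst C (sym (positionOf-at< j<n))

      rim-closed : ∀ {C} w → (∀ j → j < n → at j ≡ w → suc j < n × (C j → C (suc j)) × (C (suc j) → C j)) →
        (OnRim C (suc w) → OnRim C (suc (next w))) × (OnRim C (suc (next w)) → OnRim C (suc w))
      rim-closed {C} w shifts with positionOf w | positionOf<n w | at-positionOf w
      ... | j | j<n | refl with shifts j j<n refl
      ...   | sj<n , right , left rewrite next-at j =
        (λ q → onRim-intro {C} sj<n (right q)) , (λ q → left (onRim-elim {C} sj<n q))

      spoke-closed : ∀ {C} w → (∀ i → i < n → at i ≡ w → ¬ C i) →
        (OnRim C zero → OnRim C (suc w)) × (OnRim C (suc w) → OnRim C zero)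
      spoke-closed w excluded = (λ ()) , excluded (positionOf w) (positionOf<n w) (at-positionOf w)

      -- The rim edge at position k is cut, so the arcs are intervals of positions 0 … k and
      -- seen i says that the arc of position i has a spoke at an earlier position.
      module Propagation (seen : ℕ → Bool)
                         (carry : ∀ i → i < n → kept (at i) ≡ true → seen (suc i) ≡ seen i ∨ hasSpoke (at i))
                         (last-cut : kept (at k) ≡ false) where

        covered : ℕ → Bool
        covered i = seen i ∨ hasSpoke (at i)

        kept⇒suc<n : ∀ {j} → j < n → kept (at j) ≡ true → suc j < n
        kept⇒suc<n j<n kj with m≤n⇒m<n∨m≡n (s≤s⁻¹ j<n)
        ... | inj₁ j<k  = s≤s j<k
        ... | inj₂ refl = ⊥-elim (true≢false (trans (sym kj) last-cut))

        seen-right : ∀ {j i} → j ≤ i → i ≤ n → seen j ≡ true → KeptBetween j i → seen i ≡ true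
        seen-right j≤i i≤n sj kb with m≤n⇒m<n∨m≡n j≤i
        ... | inj₂ refl         = sj
        ... | inj₁ (s≤s j≤i′) =
          trans (carry _ i≤n (kb _ j≤i′ ≤-refl)) (cong (_∨ _) (seen-right j≤i′ (<⇒≤ i≤n) sj (kb-shrinkʳ kb)))

        uncovered-left : ∀ {j i} → j ≤ i → i < n → KeptBetween j i → covered i ≡ false → covered j ≡ false
        uncovered-left j≤i i<n kb ci with m≤n⇒m<n∨m≡n j≤i
        ... | inj₂ refl                     = ci
        ... | inj₁ (s≤s {n = i′} j≤i′) = uncovered-left j≤i′ i′<n (kb-shrinkʳ kb)
                                                (trans (sym (carry i′ i′<n (kb i′ j≤i′ ≤-refl))) (∨-conicalˡ _ _ ci))
          where
          i′<n : i′ < n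
          i′<n = ≤-trans (n≤1+n _) i<n

        LeftOf : ℕ → ℕ → Set
        LeftOf m i = i ≤ m × KeptBetween i m

        left-closed : ∀ {P} m → m < n → covered m ≡ false → (∀ f → P f → f ∈ S) → (∀ f → P f → f ≢ edge (rim (at m))) →
          Closed G P (OnRim (LeftOf m))
        left-closed {P} m m<n cm in-S not-m = closed-by-kind (OnRim (LeftOf m)) closed
          where
          closed : ∀ x → P (edge x) → _
          closed (rim w) p = rim-closed w shifts
            where
            shifts : ∀ j → j < n → at j ≡ w → suc j < n × (LeftOf m j → LeftOf m (suc j)) × (LeftOf m (suc j) → LeftOf m j)
            shifts j j<n refl = kept⇒suc<n j<n kj , (λ (j≤m , kb) → ≤∧≢⇒< j≤m j≢m , kb-shrinkˡ kb)
                                                , (λ (sj≤m , kb) → ≤-trans (n≤1+n j) sj≤m , kb-extendˡ kj kb)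
              where
              kj : kept (at j) ≡ true
              kj = []=⇒lookup (in-S _ p)
              j≢m : j ≢ m
              j≢m refl = not-m _ p refl
          closed (spoke w c) p = spoke-closed {LeftOf m} w λ
            { i i<n refl (i≤m , kb) → true≢false (trans (sym (hasSpoke-intro _ c ([]=⇒lookup (in-S _ p))))
                                                      (∨-conicalʳ _ _ (uncovered-left i≤m m<n kb cm))) }

        module FromLaw (one-spoke : AtMostOneSpoke) (seen-0 : seen 0 ≡ false)
                       (unseen-at-spoke : ∀ i → i < n → hasSpoke (at i) ≡ true → seen i ≡ false)
                       (covered-at-cut : ∀ i → i < n → kept (at i) ≡ false → covered i ≡ true)
                       (reset-at-cut : ∀ i → i < n → kept (at i) ≡ false → seen (suc i) ≡ false) where

          spoke-to-hub : ∀ i → hasSpoke (at i) ≡ true → Reach G (_∈ S) (suc (at i)) zero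
          spoke-to-hub i h with hasSpoke-elim (at i) h
          ... | c , p = backward (spoke (at i) c) (spokeIn⇒∈ (at i) c p) here

          unseen-to-hub : ∀ d i → d + i ≡ k → seen i ≡ false → Reach G (_∈ S) (suc (at i)) zero
          unseen-to-hub d i d+i≡k unseen with hasSpoke (at i) in h | kept (at i) in ki
          ... | true  | _     = spoke-to-hub i h
          ... | false | false = ⊥-elim (true≢false (trans (sym (covered-at-cut i i<n ki)) (cong₂ _∨_ unseen h)))
            where
            i<n : i < n
            i<n = s≤s (subst (i ≤_) d+i≡k (m≤n+m i d))
          unseen-to-hub zero    i refl _      | false | true = ⊥-elim (true≢false (trans (sym ki) last-cut))
          unseen-to-hub (suc d) i d+i≡k unseen | false | true =
            rim-step i (kept⇒∈ (at i) ki) (unseen-to-hub d (suc i) (trans (+-suc d i) d+i≡k) (trans (carry i i<n ki) (cong₂ _∨_ unseen h)))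
            where
            i<n : i < n
            i<n = s≤s (subst (i ≤_) d+i≡k (m≤n+m i (suc d)))

          seen-to-hub : ∀ i → i < n → seen i ≡ true → Reach G (_∈ S) (suc (at i)) zero
          seen-to-hub zero    _   s = ⊥-elim (true≢false (trans (sym s) seen-0))
          seen-to-hub (suc j) j<n s with kept (at j) in kj | hasSpoke (at j) in h
          ... | false | _     = ⊥-elim (true≢false (trans (sym s) (reset-at-cut j (<⇒≤ j<n) kj)))
          ... | true  | true  = rim-back j (kept⇒∈ (at j) kj) (spoke-to-hub j h)
          ... | true  | false = rim-back j (kept⇒∈ (at j) kj) (seen-to-hub j (<⇒≤ j<n) seen-j)
            where
            seen-j : seen j ≡ true
            seen-j = begin
              seen j                   ≡⟨ ∨-identityʳ (seen j) ⟨
              seen j ∨ false           ≡⟨ cong (seen j ∨_) h ⟨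
              seen j ∨ hasSpoke (at j) ≡⟨ carry j (<⇒≤ j<n) kj ⟨
              seen (suc j)             ≡⟨ s ⟩
              true                     ∎
              where open ≡-Reasoning

          reach-hub : ∀ u → Reach G (_∈ S) u zero
          reach-hub zero    = here
          reach-hub (suc w) = subst (λ v → Reach G (_∈ S) (suc v) zero) (at-positionOf w) (from (positionOf w) (positionOf<n w))
            where
            from : ∀ i → i < n → Reach G (_∈ S) (suc (at i)) zero
            from i i<n with seen i in s
            ... | false = unseen-to-hub (k ∸ i) i (m∸n+n≡m (s≤s⁻¹ i<n)) s
            ... | true  = seen-to-hub i i<n s

          connected : Connected G S
          connected u v = reach-trans (reach-hub u) (reach-sym (reach-hub v))

          no-spoke-left : ∀ {m i} → m < n → hasSpoke (at m) ≡ true → i < m → KeptBetween i m → hasSpoke (at i) ≡ false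
          no-spoke-left {suc m} m<n hm (s≤s i≤m) kb = ∨-conicalʳ _ _ (uncovered-left i≤m m′<n (kb-shrinkʳ kb) cm)
            where
            m′<n : m < n
            m′<n = ≤-trans (n≤1+n _) m<n
            cm : covered m ≡ false
            cm = trans (sym (carry m m′<n (kb m i≤m ≤-refl))) (unseen-at-spoke (suc m) m<n hm)

          no-spoke-right : ∀ {m i} → i < n → covered m ≡ true → m < i → KeptBetween m i → hasSpoke (at i) ≡ false
          no-spoke-right {m} {i} i<n cm m<i kb with hasSpoke (at i) in hi
          ... | false = refl
          ... | true  = ⊥-elim (true≢false (trans (sym seen-i) (unseen-at-spoke i i<n hi)))
            where
            seen-i : seen i ≡ true
            seen-i = seen-right m<i (<⇒≤ i<n) (trans (carry m (<-trans m<i i<n) (kb m ≤-refl m<i)) cm) (kb-shrinkˡ kb)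

          SameArc : ℕ → ℕ → Set
          SameArc m i = LeftOf m i ⊎ (m ≤ i × KeptBetween m i)

          spoke-acyclic : ∀ {m} c → m < n → NoCycleThrough (spoke (at m) c)
          spoke-acyclic {m} c m<n e∈S r = reach-closed (OnRim (SameArc m)) (closed-by-kind (OnRim (SameArc m)) closed)
                                                       (reach-sym r) (onRim-intro {SameArc m} m<n (inj₁ (≤-refl , kb-empty)))
            where
            hm : hasSpoke (at m) ≡ true
            hm = hasSpoke-intro (at m) c ([]=⇒lookup e∈S)
            closed : ∀ x → Without (edge (spoke (at m) c)) (edge x) → _
            closed (rim w) (f∈S , _) = rim-closed w shifts
              where
              shifts : ∀ j → j < n → at j ≡ w → suc j < n × (SameArc m j → SameArc m (suc j)) × (SameArc m (suc j) → SameArc m j)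
              shifts j j<n refl = kept⇒suc<n j<n kj , right , left
                where
                kj : kept (at j) ≡ true
                kj = []=⇒lookup f∈S
                right : SameArc m j → SameArc m (suc j)
                right (inj₁ (j≤m , kb)) with m≤n⇒m<n∨m≡n j≤m
                ... | inj₁ j<m  = inj₁ (j<m , kb-shrinkˡ kb)
                ... | inj₂ refl = inj₂ (n≤1+n j , kb-extendʳ kj kb-empty)
                right (inj₂ (m≤j , kb)) = inj₂ (≤-trans m≤j (n≤1+n j) , kb-extendʳ kj kb)
                left : SameArc m (suc j) → SameArc m j
                left (inj₁ (sj≤m , kb)) = inj₁ (≤-trans (n≤1+n j) sj≤m , kb-extendˡ kj kb)
                left (inj₂ (m≤sj , kb)) with m≤n⇒m<n∨m≡n m≤sj
                ... | inj₁ m<sj = inj₂ (s≤s⁻¹ m<sj , kb-shrinkʳ kb)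
                ... | inj₂ refl = inj₁ (n≤1+n j , kb-extendˡ kj kb-empty)
            closed (spoke w c′) (f∈S , f≢e) = spoke-closed {SameArc m} w excluded
              where
              hi : hasSpoke w ≡ true
              hi = hasSpoke-intro w c′ ([]=⇒lookup f∈S)
              same-spoke : w ≡ at m → ⊥
              same-spoke refl = f≢e (cong (λ z → edge (spoke (at m) z)) (one-spoke (at m) c′ c ([]=⇒lookup f∈S) ([]=⇒lookup e∈S)))
              excluded : ∀ i → i < n → at i ≡ w → ¬ SameArc m i
              excluded i i<n refl (inj₁ (i≤m , kb)) with m≤n⇒m<n∨m≡n i≤m
              ... | inj₁ i<m  = true≢false (trans (sym hi) (no-spoke-left m<n hm i<m kb))
              ... | inj₂ refl = same-spoke refl
              excluded i i<n refl (inj₂ (m≤i , kb)) with m≤n⇒m<n∨m≡n m≤i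
              ... | inj₁ m<i  = true≢false (trans (sym hi) (no-spoke-right i<n (trans (cong (seen m ∨_) hm) (∨-zeroʳ _)) m<i kb))
              ... | inj₂ refl = same-spoke refl

          rim-acyclic-uncovered : ∀ {m} → m < n → covered m ≡ false → edge (rim (at m)) ∈ S →
            ¬ Reach G (Without (edge (rim (at m)))) (suc (at m)) (suc (at (suc m)))
          rim-acyclic-uncovered {m} m<n cm e∈S r = <-irrefl refl (proj₁ (onRim-elim {LeftOf m} sm<n
            (reach-closed (OnRim (LeftOf m)) (left-closed m m<n cm (λ _ → proj₁) (λ _ → proj₂)) r
                          (onRim-intro {LeftOf m} m<n (≤-refl , kb-empty)))))
            where
            sm<n : suc m < n
            sm<n = kept⇒suc<n m<n ([]=⇒lookup e∈S)

          RightOf : ℕ → ℕ → Set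
          RightOf m i = m < i × KeptBetween (suc m) i

          rim-acyclic-covered : ∀ {m} → m < n → covered m ≡ true → edge (rim (at m)) ∈ S →
            ¬ Reach G (Without (edge (rim (at m)))) (suc (at m)) (suc (at (suc m)))
          rim-acyclic-covered {m} m<n cm e∈S r = <-irrefl refl (proj₁ (onRim-elim {RightOf m} m<n
            (reach-closed (OnRim (RightOf m)) (closed-by-kind (OnRim (RightOf m)) closed) (reach-sym r)
                          (onRim-intro {RightOf m} sm<n (≤-refl , kb-empty)))))
            where
            km : kept (at m) ≡ true
            km = []=⇒lookup e∈S
            sm<n : suc m < n
            sm<n = kept⇒suc<n m<n km
            closed : ∀ x → Without (edge (rim (at m))) (edge x) → _
            closed (rim w) (f∈S , f≢e) = rim-closed w shifts
              where
              shifts : ∀ j → j < n → at j ≡ w → suc j < n × (RightOf m j → RightOf m (suc j)) × (RightOf m (suc j) → RightOf m j)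
              shifts j j<n refl = kept⇒suc<n j<n kj , (λ (m<j , kb) → ≤-trans m<j (n≤1+n j) , kb-extendʳ kj kb)
                                                  , (λ (m<sj , kb) → ≤∧≢⇒< (s≤s⁻¹ m<sj) m≢j , kb-shrinkʳ kb)
                where
                kj : kept (at j) ≡ true
                kj = []=⇒lookup f∈S
                m≢j : m ≢ j
                m≢j refl = f≢e refl
            closed (spoke w c) (f∈S , _) = spoke-closed {RightOf m} w λ
              { i i<n refl (m<i , kb) → true≢false (trans (sym (hasSpoke-intro _ c ([]=⇒lookup f∈S)))
                                                         (no-spoke-right i<n cm m<i (kb-extendˡ km kb))) }

          rim-acyclic : ∀ {m} → m < n → NoCycleThrough (rim (at m))
          rim-acyclic {m} m<n e∈S r = by-cover (covered m) refl (subst (Reach G (Without (edge (rim (at m)))) (suc (at m)) ∘ suc) (next-at m) r)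
            where
            by-cover : ∀ c → covered m ≡ c → ¬ Reach G (Without (edge (rim (at m)))) (suc (at m)) (suc (at (suc m)))
            by-cover false cm = rim-acyclic-uncovered m<n cm e∈S
            by-cover true  cm = rim-acyclic-covered m<n cm e∈S

          acyclic : Acyclic G S
          acyclic = acyclic-by-kind no-cycle
            where
            no-cycle : ∀ x → NoCycleThrough x
            no-cycle (rim w) with positionOf w | positionOf<n w | at-positionOf w
            ... | m | m<n | refl = rim-acyclic m<n
            no-cycle (spoke w c) with positionOf w | positionOf<n w | at-positionOf w
            ... | m | m<n | refl = spoke-acyclic c m<n

          spanning-tree : IsSpanningTree G S
          spanning-tree = connected , acyclic

    module FromTree (connected : Connected G S) (acyclic : Acyclic G S) where

      at-most-one-spoke : AtMostOneSpoke
      at-most-one-spoke v c c′ p p′ with c ≟ c′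
      ... | yes c≡c′ = c≡c′
      ... | no c≢c′  = ⊥-elim (no-cycle-through acyclic (spoke v c) (spokeIn⇒∈ v c p)
                                                  (forward (spoke v c′) (spokeIn⇒∈ v c′ p′ , distinct) here))
        where
        distinct : edge (spoke v c′) ≢ edge (spoke v c)
        distinct eq = c≢c′ (sym (cong (proj₂ ∘ [ (λ v → v , c) , id ]′) (edge-injective {spoke v c′} {spoke v c} eq)))

      not-all-kept : ¬ (∀ v → kept v ≡ true)
      not-all-kept all-kept = no-cycle-through acyclic (rim (at 0)) (kept⇒∈ (at 0) (all-kept (at 0)))
        (subst (Reach G (Without (edge (rim (at 0)))) (suc (at 0)) ∘ suc) (sym (next-at 0)) (reach-sym around))
        where
        open Arcs 0
        others : ∀ l → 1 ≤ l → l < n → Without (edge (rim (at 0))) (edge (rim (at l)))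
        others l 1≤l l<n = kept⇒∈ (at l) (all-kept (at l)) ,
          λ eq → <-irrefl (sym (at-injective l<n (s≤s z≤n) (cong vertex (edge-injective {rim (at l)} {rim (at 0)} eq)))) 1≤l
        around : Reach G (Without (edge (rim (at 0)))) (suc (at 1)) (suc (at 0))
        around = subst (Reach G (Without (edge (rim (at 0)))) (suc (at 1)) ∘ suc) at-periodic (rim-walk (s≤s z≤n) others)

      some-cut : ∃ λ v → kept v ≡ false
      some-cut with all? (λ v → Bool._≟_ (kept v) true)
      ... | yes all-kept = ⊥-elim (not-all-kept all-kept)
      ... | no ¬all-kept = map₂ ¬-not (¬∀⟶∃¬ n _ (λ v → Bool._≟_ (kept v) true) ¬all-kept)

      module FromCut (cut : Fin n) (cut-removed : kept cut ≡ false) where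

        open Arcs (suc (toℕ cut))
        open Modular.RotationAfter k cut using (at-last)

        seen : ℕ → Bool
        seen zero    = false
        seen (suc i) = if kept (at i) then seen i ∨ hasSpoke (at i) else false

        carry : ∀ i → i < n → kept (at i) ≡ true → seen (suc i) ≡ seen i ∨ hasSpoke (at i)
        carry i _ ki rewrite ki = refl

        reset-at-cut : ∀ i → i < n → kept (at i) ≡ false → seen (suc i) ≡ false
        reset-at-cut i _ ki rewrite ki = refl

        open Propagation seen carry (subst (λ v → kept v ≡ false) (sym at-last) cut-removed)

        seen-source : ∀ i → seen i ≡ true → Σ ℕ λ j → j < i × hasSpoke (at j) ≡ true × KeptBetween j i
        seen-source (suc i) s with kept (at i) in ki | hasSpoke (at i) in hi
        ... | false | _    = ⊥-elim (true≢false (sym s))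
        ... | true  | true = i , ≤-refl , hi , kb-extendʳ ki kb-empty
        ... | true  | false with seen-source i (trans (sym (∨-identityʳ (seen i))) s)
        ...   | j , j<i , hj , kb = j , m≤n⇒m≤1+n j<i , hj , kb-extendʳ ki kb

        unseen-at-spoke : ∀ i → i < n → hasSpoke (at i) ≡ true → seen i ≡ false
        unseen-at-spoke i i<n hi with seen i in si
        ... | false = refl
        ... | true with seen-source i si | hasSpoke-elim (at i) hi
        ...   | j , j<i , hj , kb | c , pc with hasSpoke-elim (at j) hj
        ...     | cj , pcj = ⊥-elim (no-cycle-through acyclic (spoke (at i) c) (spokeIn⇒∈ (at i) c pc) cycle)
          where
          e : Fin (E G)
          e = edge (spoke (at i) c)
          distinct : edge (spoke (at j) cj) ≢ e
          distinct eq = <-irrefl (at-injective (<-trans j<i i<n) i<n (cong vertex (edge-injective {spoke (at j) cj} {spoke (at i) c} eq))) j<i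
          on-rim : ∀ l → j ≤ l → l < i → Without e (edge (rim (at l)))
          on-rim l j≤l l<i = kept⇒∈ (at l) (kb l j≤l l<i) , λ eq → case edge-injective {rim (at l)} {spoke (at i) c} eq of λ ()
          cycle : Reach G (Without e) zero (suc (at i))
          cycle = forward (spoke (at j) cj) (spokeIn⇒∈ (at j) cj pcj , distinct) (rim-walk (<⇒≤ j<i) on-rim)

        covered-at-cut : ∀ i → i < n → kept (at i) ≡ false → covered i ≡ true
        covered-at-cut i i<n ki with covered i in ci
        ... | true  = refl
        ... | false = ⊥-elim (reach-closed (OnRim (LeftOf i)) (left-closed i i<n ci (λ _ p → p) not-rim) (connected (suc (at i)) zero)
                                           (onRim-intro {LeftOf i} i<n (≤-refl , kb-empty)))
          where
          not-rim : ∀ f → f ∈ S → f ≢ edge (rim (at i))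
          not-rim f p refl = true≢false (trans (sym ([]=⇒lookup p)) ki)

        law-at : ∀ i → i < n → Law (seen i) (cellOf (at i)) (seen (positionOf (next (at i))))
        law-at i i<n = record
          { unseen-at-spoke = unseen-at-spoke i i<n
          ; carried         = λ ki → trans (cong seen (trans after (positionOf-at< (kept⇒suc<n i<n ki)))) (carry i i<n ki)
          ; covered-at-cut  = covered-at-cut i i<n
          ; reset-at-cut    = λ ki → trans (cong seen (trans after (positionOf-at (suc i)))) (reset ki)
          }
          where
          after : positionOf (next (at i)) ≡ positionOf (at (suc i))
          after = cong positionOf (next-at i)
          reset : kept (at i) ≡ false → seen (suc i % n) ≡ false
          reset ki with m≤n⇒m<n∨m≡n (s≤s⁻¹ i<n)
          ... | inj₁ i<k  = trans (cong seen (m<n⇒m%n≡m (s≤s i<k))) (reset-at-cut i i<n ki)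
          ... | inj₂ refl = cong seen (n%n≡0 n)

        cyclic-law : CyclicLaw cellOf
        cyclic-law = seen ∘ positionOf , law
          where
          law : ∀ v → Law (seen (positionOf v)) (cellOf v) (seen (positionOf (next v)))
          law v with positionOf v | positionOf<n v | at-positionOf v
          ... | i | i<n | refl = law-at i i<n

    tree⇒law : IsSpanningTree G S → AtMostOneSpoke × CyclicLaw cellOf × HasCut cellOf
    tree⇒law (connected , acyclic) = at-most-one-spoke , FromCut.cyclic-law (proj₁ some-cut) (proj₂ some-cut) , some-cut
      where open FromTree connected acyclic

    law⇒tree : AtMostOneSpoke → CyclicLaw cellOf → HasCut cellOf → IsSpanningTree G S
    law⇒tree one-spoke (seen′ , law) (cut , cut-removed) = spanning-tree
      where
      open Arcs (suc (toℕ cut))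
      open Modular.RotationAfter k cut using (at-last; at-first)

      seen : ℕ → Bool
      seen i = seen′ (at i)

      along : ∀ i → seen′ (next (at i)) ≡ seen (suc i)
      along i = cong seen′ (next-at i)

      open Propagation seen (λ i _ ki → trans (sym (along i)) (Law.carried (law (at i)) ki))
                            (subst (λ v → kept v ≡ false) (sym at-last) cut-removed)
      open FromLaw one-spoke (trans (cong seen′ at-first) (Law.reset-at-cut (law cut) cut-removed))
                   (λ i _ → Law.unseen-at-spoke (law (at i))) (λ i _ → Law.covered-at-cut (law (at i)))
                   (λ i _ ki → trans (sym (along i)) (Law.reset-at-cut (law (at i)) ki))

-- Spanning trees as cyclic words

module Bijection (a k : ℕ) where

  open Wheel a k

  bit : Vec (Cell a) n → WheelEdge n a → Bool
  bit w (rim v)     = proj₁ (lookup w v)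
  bit w (spoke v c) = isChoice (proj₂ (lookup w v)) c

  decode : Vec (Cell a) n → Subset (E G)
  decode w = tabulate (bit w ∘ kind)

  encode : Subset (E G) → Vec (Cell a) n
  encode S = tabulate (Subgraph.cellOf S)

  lookup-decode : ∀ w x → lookup (decode w) (edge x) ≡ bit w x
  lookup-decode w x = trans (lookup∘tabulate (bit w ∘ kind) (edge x)) (cong (bit w) (kind-edge x))

  encode-decode : ∀ w → encode (decode w) ≡ w
  encode-decode w = trans (tabulate-cong cell) (tabulate∘lookup w)
    where
    cell : ∀ v → Subgraph.cellOf (decode w) v ≡ lookup w v
    cell v = cong₂ _,_ (lookup-decode w (rim v))
                       (Subgraph.chosen-spec (decode w) v _ (λ c → lookup-decode w (spoke v c)))

  decode-encode : ∀ S → Subgraph.AtMostOneSpoke S → decode (encode S) ≡ S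
  decode-encode S one-spoke = trans (tabulate-cong (λ e → trans (bit-encode (kind e)) (cong (lookup S) (edge-kind e))))
                                    (tabulate∘lookup S)
    where
    bit-encode : ∀ x → bit (encode S) x ≡ lookup S (edge x)
    bit-encode (rim v)     = cong proj₁ (lookup∘tabulate (Subgraph.cellOf S) v)
    bit-encode (spoke v c) = trans (cong (λ x → isChoice (proj₂ x) c) (lookup∘tabulate (Subgraph.cellOf S) v))
                                   (Subgraph.isChoice-chosen S one-spoke v c)

  decode-one-spoke : ∀ w → Subgraph.AtMostOneSpoke (decode w)
  decode-one-spoke w v c c′ p p′ = just-injective (trans (sym (choice c p)) (choice c′ p′))
    where
    choice : ∀ c → lookup (decode w) (edge (spoke v c)) ≡ true → proj₂ (lookup w v) ≡ just c
    choice c p = isChoice-true _ c (trans (sym (lookup-decode w (spoke v c))) p)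
    just-injective : ∀ {c c′ : Fin a} → just c ≡ just c′ → c ≡ c′
    just-injective refl = refl

  Accepted : Set
  Accepted = Σ (Vec (Cell a) n) CyclicRun

  spanningTree↔accepted : SpanningTree G ↔ Accepted
  spanningTree↔accepted = mk↔ₛ′ to from to-from from-to
    where
    to : SpanningTree G → Accepted
    to (S , Irrelevant.[ tree ]) = encode S , recompute (cyclicRun? (encode S))
                                     (law⇒cyclicRun _ (proj₂ (Subgraph.tree⇒law S tree)))

    from : Accepted → SpanningTree G
    from (w , run) = decode w , Irrelevant.[ uncurry (Subgraph.law⇒tree (decode w) (decode-one-spoke w))
      (cyclicRun⇒law (Subgraph.cellOf (decode w)) (subst CyclicRun (sym (encode-decode w)) run)) ]

    to-from : ∀ x → to (from x) ≡ x
    to-from (w , run) = lemma (encode-decode w)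
      where
      lemma : ∀ {w′} {run′ : CyclicRun w′} → w′ ≡ w → (w′ , run′) ≡ (w , run)
      lemma refl = cong (w ,_) (cyclicRun-irrelevant w _ run)

    from-to : ∀ t → from (to t) ≡ t
    from-to (S , Irrelevant.[ tree ]) = value-injective
      (recompute (Vec.≡-dec Bool._≟_ (decode (encode S)) S) (decode-encode S (proj₁ (Subgraph.tree⇒law S tree))))

-- Counting cyclic words

_≟ₛ_ : (σ σ′ : State) → Dec (σ ≡ σ′)
_≟ₛ_ = Product.≡-dec Bool._≟_ Bool._≟_

module Counting (a : ℕ) where

  Runs : ℕ → State → State → Set
  Runs m σ σ′ = Σ (Vec (Cell a) m) λ w → run σ w ≡ just σ′

  count : ℕ → State → State → ℕ
  count zero    σ           σ′ = if does (σ ≟ₛ σ′) then 1 else 0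
  count (suc m) (false , f) σ′ = count m (false , f) σ′ + (a * count m (true , f) σ′ + a * count m (false , true) σ′)
  count (suc m) (true  , f) σ′ = count m (true , f) σ′ + count m (false , true) σ′

  runs-zero : ∀ σ σ′ → Runs 0 σ σ′ ↔ Fin (count 0 σ σ′)
  runs-zero σ σ′ with σ ≟ₛ σ′
  ... | yes refl = mk↔ₛ′ (λ _ → zero) (λ _ → [] , refl) (λ { zero → refl }) (λ { ([] , p) → cong ([] ,_) (uip refl p) })
  ... | no σ≢σ′  = mk↔ₛ′ (λ { ([] , refl) → ⊥-elim (σ≢σ′ refl) }) (λ ()) (λ ()) (λ { ([] , refl) → ⊥-elim (σ≢σ′ refl) })

  runs-unseen : ∀ m f σ′ → Runs (suc m) (false , f) σ′ ↔
    (Runs m (false , f) σ′ ⊎ ((Fin a × Runs m (true , f) σ′) ⊎ (Fin a × Runs m (false , true) σ′)))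
  runs-unseen m f σ′ = mk↔ₛ′ to from to-from from-to
    where
    to : Runs (suc m) (false , f) σ′ → _
    to ((true  , nothing) ∷ w , r) = inj₁ (w , r)
    to ((true  , just c)  ∷ w , r) = inj₂ (inj₁ (c , w , r))
    to ((false , just c)  ∷ w , r) = inj₂ (inj₂ (c , w , r))
    to ((false , nothing) ∷ w , ())
    from : _ → Runs (suc m) (false , f) σ′
    from (inj₁ (w , r))              = (true , nothing) ∷ w , r
    from (inj₂ (inj₁ (c , w , r)))   = (true , just c) ∷ w , r
    from (inj₂ (inj₂ (c , w , r)))   = (false , just c) ∷ w , r
    to-from : ∀ y → to (from y) ≡ y
    to-from (inj₁ _)        = refl
    to-from (inj₂ (inj₁ _)) = refl
    to-from (inj₂ (inj₂ _)) = refl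
    from-to : ∀ x → from (to x) ≡ x
    from-to ((true  , nothing) ∷ w , r) = refl
    from-to ((true  , just c)  ∷ w , r) = refl
    from-to ((false , just c)  ∷ w , r) = refl
    from-to ((false , nothing) ∷ w , ())

  runs-seen : ∀ m f σ′ → Runs (suc m) (true , f) σ′ ↔ (Runs m (true , f) σ′ ⊎ Runs m (false , true) σ′)
  runs-seen m f σ′ = mk↔ₛ′ to from to-from from-to
    where
    to : Runs (suc m) (true , f) σ′ → _
    to ((true  , nothing) ∷ w , r) = inj₁ (w , r)
    to ((false , nothing) ∷ w , r) = inj₂ (w , r)
    to ((true  , just _)  ∷ w , ())
    to ((false , just _)  ∷ w , ())
    from : _ → Runs (suc m) (true , f) σ′
    from (inj₁ (w , r)) = (true , nothing) ∷ w , r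
    from (inj₂ (w , r)) = (false , nothing) ∷ w , r
    to-from : ∀ y → to (from y) ≡ y
    to-from (inj₁ _) = refl
    to-from (inj₂ _) = refl
    from-to : ∀ x → from (to x) ≡ x
    from-to ((true  , nothing) ∷ w , r) = refl
    from-to ((false , nothing) ∷ w , r) = refl
    from-to ((true  , just _)  ∷ w , ())
    from-to ((false , just _)  ∷ w , ())

  runs↔count : ∀ m σ σ′ → Runs m σ σ′ ↔ Fin (count m σ σ′)
  runs↔count zero    σ           σ′ = runs-zero σ σ′
  runs↔count (suc m) (false , f) σ′ = ↔-trans (runs-unseen m f σ′) (↔-sym (↔-trans +↔⊎
    (↔-sym (runs↔count m _ σ′) ⊎-↔ ↔-trans +↔⊎ (weighted (runs↔count m _ σ′) ⊎-↔ weighted (runs↔count m _ σ′)))))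
    where
    weighted : ∀ {R c} → R ↔ Fin c → Fin (a * c) ↔ (Fin a × R)
    weighted R↔c = ↔-trans *↔× (↔-refl ×-↔ ↔-sym R↔c)
  runs↔count (suc m) (true  , f) σ′ = ↔-trans (runs-seen m f σ′) (↔-sym (↔-trans +↔⊎
    (↔-sym (runs↔count m _ σ′) ⊎-↔ ↔-sym (runs↔count m _ σ′))))

  cyclicRuns : ℕ → ℕ
  cyclicRuns m = count m (false , false) (false , true) + count m (true , false) (true , true)

  cyclicRuns↔ : ∀ m → Σ (Vec (Cell a) m) CyclicRun ↔ Fin (cyclicRuns m)
  cyclicRuns↔ m = ↔-trans split (↔-sym (↔-trans +↔⊎ (↔-sym (runs↔count m _ _) ⊎-↔ ↔-sym (runs↔count m _ _))))
    where
    split : Σ (Vec (Cell a) m) CyclicRun ↔ (Runs m (false , false) (false , true) ⊎ Runs m (true , false) (true , true))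
    split = mk↔ₛ′ (λ { (w , false , r) → inj₁ (w , r) ; (w , true , r) → inj₂ (w , r) })
                  (λ { (inj₁ (w , r)) → w , false , r ; (inj₂ (w , r)) → w , true , r })
                  (λ { (inj₁ _) → refl ; (inj₂ _) → refl })
                  (λ { (w , false , r) → refl ; (w , true , r) → refl })

  count-keeps-cut : ∀ m s s′ → count m (s , true) (s′ , false) ≡ 0
  count-keeps-cut zero    false false = refl
  count-keeps-cut zero    false true  = refl
  count-keeps-cut zero    true  false = refl
  count-keeps-cut zero    true  true  = refl
  count-keeps-cut (suc m) false s′ rewrite count-keeps-cut m false s′ | count-keeps-cut m true s′ | *-zeroʳ a = refl
  count-keeps-cut (suc m) true  s′ rewrite count-keeps-cut m false s′ | count-keeps-cut m true s′ = refl

  uncut-seen-to-unseen : ∀ m → count m (true , false) (false , false) ≡ 0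
  uncut-seen-to-unseen zero = refl
  uncut-seen-to-unseen (suc m) rewrite uncut-seen-to-unseen m | count-keeps-cut m false false = refl

  uncut-seen-to-seen : ∀ m → count m (true , false) (true , false) ≡ 1
  uncut-seen-to-seen zero = refl
  uncut-seen-to-seen (suc m) rewrite uncut-seen-to-seen m | count-keeps-cut m false true = refl

  uncut-unseen-to-unseen : ∀ m → count m (false , false) (false , false) ≡ 1
  uncut-unseen-to-unseen zero = refl
  uncut-unseen-to-unseen (suc m)
    rewrite uncut-unseen-to-unseen m | uncut-seen-to-unseen m | count-keeps-cut m false false | *-zeroʳ a = refl

  count-forget-cut : ∀ m s s′ → count m (s , false) (s′ , true) + count m (s , false) (s′ , false) ≡ count m (s , true) (s′ , true)
  count-forget-cut zero    false false = refl
  count-forget-cut zero    false true  = refl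
  count-forget-cut zero    true  false = refl
  count-forget-cut zero    true  true  = refl
  count-forget-cut (suc m) false s′ rewrite count-keeps-cut m false s′ =
    trans (regroup a (count m (false , false) (s′ , true)) (count m (true , false) (s′ , true)) (count m (false , true) (s′ , true))
                     (count m (false , false) (s′ , false)) (count m (true , false) (s′ , false)))
          (cong₂ (λ u v → u + (a * v + a * count m (false , true) (s′ , true))) (count-forget-cut m false s′) (count-forget-cut m true s′))
    where
    regroup : ∀ a u v w u′ v′ → (u + (a * v + a * w)) + (u′ + (a * v′ + a * 0)) ≡ (u + u′) + (a * (v + v′) + a * w)
    regroup = ℕ-Ring.solve-∀
  count-forget-cut (suc m) true  s′ rewrite count-keeps-cut m false s′ =
    trans (regroup (count m (true , false) (s′ , true)) (count m (false , true) (s′ , true)) (count m (true , false) (s′ , false)))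
          (cong (_+ count m (false , true) (s′ , true)) (count-forget-cut m true s′))
    where
    regroup : ∀ u w u′ → (u + w) + (u′ + 0) ≡ (u + u′) + w
    regroup = ℕ-Ring.solve-∀

  cyclicRuns+2 : ∀ m → cyclicRuns m + 2 ≡ count m (false , true) (false , true) + count m (true , true) (true , true)
  cyclicRuns+2 m = begin
    u + v + 2
      ≡⟨ regroup u v ⟩
    (u + 1) + (v + 1)
      ≡⟨ cong₂ (λ p q → (u + p) + (v + q)) (uncut-unseen-to-unseen m) (uncut-seen-to-seen m) ⟨
    (u + count m (false , false) (false , false)) + (v + count m (true , false) (true , false))
      ≡⟨ cong₂ _+_ (count-forget-cut m false false) (count-forget-cut m true true) ⟩
    count m (false , true) (false , true) + count m (true , true) (true , true)
      ∎
    where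
    open ≡-Reasoning
    u v : ℕ
    u = count m (false , false) (false , true)
    v = count m (true , false) (true , true)
    regroup : ∀ u v → u + v + 2 ≡ (u + 1) + (v + 1)
    regroup = ℕ-Ring.solve-∀

-- The trace recurrence

SatisfiesRecurrence : ℤ → (ℕ → ℤ) → Set
SatisfiesRecurrence c u = ∀ m → u (suc (suc m)) ≡ c ℤ.* u (suc m) ℤ.- u m

recurrence-+ : ∀ {c u v} → SatisfiesRecurrence c u → SatisfiesRecurrence c v → SatisfiesRecurrence c (λ m → u m ℤ.+ v m)
recurrence-+ {c} {u} {v} rec-u rec-v m =
  trans (cong₂ ℤ._+_ (rec-u m) (rec-v m)) (linear c (u (suc m)) (u m) (v (suc m)) (v m))
  where
  linear : ∀ c u₁ u₀ v₁ v₀ → (c ℤ.* u₁ ℤ.- u₀) ℤ.+ (c ℤ.* v₁ ℤ.- v₀) ≡ c ℤ.* (u₁ ℤ.+ v₁) ℤ.- (u₀ ℤ.+ v₀)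
  linear = ℤ-Ring.solve-∀

recurrence-unique : ∀ {c u v} → SatisfiesRecurrence c u → SatisfiesRecurrence c v → u 0 ≡ v 0 → u 1 ≡ v 1 → ∀ m → u m ≡ v m
recurrence-unique {c} {u} {v} rec-u rec-v eq₀ eq₁ = agree
  where
  agree : ∀ m → u m ≡ v m
  agree zero          = eq₀
  agree (suc zero)    = eq₁
  agree (suc (suc m)) = trans (rec-u m) (trans (cong₂ (λ p q → c ℤ.* p ℤ.- q) (agree (suc m)) (agree m)) (sym (rec-v m)))

-- Cayley–Hamilton for M = [[1+A, A], [1, 1]], whose trace is A + 2 and determinant 1.
module CayleyHamilton (A : ℤ) (x y : ℕ → ℤ)
                      (x-step : ∀ m → x (suc m) ≡ x m ℤ.+ (A ℤ.* y m ℤ.+ A ℤ.* x m))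
                      (y-step : ∀ m → y (suc m) ≡ y m ℤ.+ x m) where

  x-rec : SatisfiesRecurrence (A ℤ.+ + 2) x
  x-rec m = begin
    x (suc (suc m))                                               ≡⟨ x-step (suc m) ⟩
    x (suc m) ℤ.+ (A ℤ.* y (suc m) ℤ.+ A ℤ.* x (suc m))           ≡⟨ cong₂ (λ u v → u ℤ.+ (A ℤ.* v ℤ.+ A ℤ.* u)) (x-step m) (y-step m) ⟩
    x′ ℤ.+ (A ℤ.* (y m ℤ.+ x m) ℤ.+ A ℤ.* x′)                     ≡⟨ identity A (x m) (y m) ⟩
    (A ℤ.+ + 2) ℤ.* x′ ℤ.- x m                                    ≡⟨ cong (λ u → (A ℤ.+ + 2) ℤ.* u ℤ.- x m) (x-step m) ⟨
    (A ℤ.+ + 2) ℤ.* x (suc m) ℤ.- x m                             ∎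
    where
    open ≡-Reasoning
    x′ : ℤ
    x′ = x m ℤ.+ (A ℤ.* y m ℤ.+ A ℤ.* x m)
    identity : ∀ A x y → let x′ = x ℤ.+ (A ℤ.* y ℤ.+ A ℤ.* x) in
                         x′ ℤ.+ (A ℤ.* (y ℤ.+ x) ℤ.+ A ℤ.* x′) ≡ (A ℤ.+ + 2) ℤ.* x′ ℤ.- x
    identity = ℤ-Ring.solve-∀

  y-rec : SatisfiesRecurrence (A ℤ.+ + 2) y
  y-rec m = begin
    y (suc (suc m))                                        ≡⟨ y-step (suc m) ⟩
    y (suc m) ℤ.+ x (suc m)                                ≡⟨ cong₂ ℤ._+_ (y-step m) (x-step m) ⟩
    (y m ℤ.+ x m) ℤ.+ (x m ℤ.+ (A ℤ.* y m ℤ.+ A ℤ.* x m))  ≡⟨ identity A (x m) (y m) ⟩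
    (A ℤ.+ + 2) ℤ.* (y m ℤ.+ x m) ℤ.- y m                  ≡⟨ cong (λ u → (A ℤ.+ + 2) ℤ.* u ℤ.- y m) (y-step m) ⟨
    (A ℤ.+ + 2) ℤ.* y (suc m) ℤ.- y m                      ∎
    where
    open ≡-Reasoning
    identity : ∀ A x y → (y ℤ.+ x) ℤ.+ (x ℤ.+ (A ℤ.* y ℤ.+ A ℤ.* x)) ≡ (A ℤ.+ + 2) ℤ.* (y ℤ.+ x) ℤ.- y
    identity = ℤ-Ring.solve-∀

module Trace (a : ℕ) where

  open Counting a

  A : ℤ
  A = + a

  -- Runs that have already cut a rim edge, from an unseen (x) or seen (y) state to seen-state s′.
  x y : Bool → ℕ → ℤ
  x s′ m = + count m (false , true) (s′ , true)
  y s′ m = + count m (true , true) (s′ , true)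

  x-step : ∀ s′ m → x s′ (suc m) ≡ x s′ m ℤ.+ (A ℤ.* y s′ m ℤ.+ A ℤ.* x s′ m)
  x-step s′ m = begin
    + (count m (false , true) (s′ , true) + (a * count m (true , true) (s′ , true) + a * count m (false , true) (s′ , true)))
      ≡⟨ pos-+ (count m (false , true) (s′ , true)) _ ⟩
    x s′ m ℤ.+ + (a * count m (true , true) (s′ , true) + a * count m (false , true) (s′ , true))
      ≡⟨ cong (λ u → x s′ m ℤ.+ u) (pos-+ (a * count m (true , true) (s′ , true)) _) ⟩
    x s′ m ℤ.+ (+ (a * count m (true , true) (s′ , true)) ℤ.+ + (a * count m (false , true) (s′ , true)))
      ≡⟨ cong (λ u → x s′ m ℤ.+ u) (cong₂ ℤ._+_ (pos-* a (count m (true , true) (s′ , true))) (pos-* a (count m (false , true) (s′ , true)))) ⟩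
    x s′ m ℤ.+ (A ℤ.* y s′ m ℤ.+ A ℤ.* x s′ m)
      ∎
    where open ≡-Reasoning

  y-step : ∀ s′ m → y s′ (suc m) ≡ y s′ m ℤ.+ x s′ m
  y-step s′ m = pos-+ (count m (true , true) (s′ , true)) (count m (false , true) (s′ , true))

  trace : ℕ → ℤ
  trace m = x false m ℤ.+ y true m

  trace-rec : SatisfiesRecurrence (A ℤ.+ + 2) trace
  trace-rec = recurrence-+ {A ℤ.+ + 2} {x false} {y true}
    (CayleyHamilton.x-rec A (x false) (y false) (x-step false) (y-step false))
    (CayleyHamilton.y-rec A (x true) (y true) (x-step true) (y-step true))

  trace-1 : trace 1 ≡ A ℤ.+ + 2
  trace-1 rewrite *-zeroʳ a | *-identityʳ a = cong +_ (sym (+-suc a 1))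

  cyclicRuns-trace : ∀ m → + cyclicRuns m ℤ.+ + 2 ≡ trace m
  cyclicRuns-trace m = begin
    + cyclicRuns m ℤ.+ + 2  ≡⟨ pos-+ (cyclicRuns m) 2 ⟨
    + (cyclicRuns m + 2)    ≡⟨ cong +_ (cyclicRuns+2 m) ⟩
    trace m                 ∎
    where open ≡-Reasoning

  trace-Wpoly : ∀ m → trace (suc m) ≡ A ℤ.* Wpoly m A ℤ.+ + 2
  trace-Wpoly zero          = trans trace-1 (identity A)
    where
    identity : ∀ A → A ℤ.+ + 2 ≡ A ℤ.* + 1 ℤ.+ + 2
    identity = ℤ-Ring.solve-∀
  trace-Wpoly (suc zero)    = trans (trace-rec 0) (trans (cong (λ u → (A ℤ.+ + 2) ℤ.* u ℤ.- + 2) trace-1) (identity A))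
    where
    identity : ∀ A → (A ℤ.+ + 2) ℤ.* (A ℤ.+ + 2) ℤ.- + 2 ≡ A ℤ.* (A ℤ.+ + 4) ℤ.+ + 2
    identity = ℤ-Ring.solve-∀
  trace-Wpoly (suc (suc m)) = trans (trace-rec (suc m))
    (trans (cong₂ (λ u v → (A ℤ.+ + 2) ℤ.* u ℤ.- v) (trace-Wpoly (suc m)) (trace-Wpoly m)) (identity A (Wpoly (suc m) A) (Wpoly m A)))
    where
    identity : ∀ A w₁ w₀ → (A ℤ.+ + 2) ℤ.* (A ℤ.* w₁ ℤ.+ + 2) ℤ.- (A ℤ.* w₀ ℤ.+ + 2)
                           ≡ A ℤ.* ((A ℤ.+ + 2) ℤ.* w₁ ℤ.- w₀ ℤ.+ + 2) ℤ.+ + 2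
    identity = ℤ-Ring.solve-∀

  cyclicRuns-Wpoly : ∀ m → + cyclicRuns (suc m) ≡ A ℤ.* Wpoly m A
  cyclicRuns-Wpoly m = begin
    + cyclicRuns (suc m)                            ≡⟨ identity (+ cyclicRuns (suc m)) ⟩
    (+ cyclicRuns (suc m) ℤ.+ + 2) ℤ.- + 2          ≡⟨ cong (ℤ._- + 2) (trans (cyclicRuns-trace (suc m)) (trace-Wpoly m)) ⟩
    (A ℤ.* Wpoly m A ℤ.+ + 2) ℤ.- + 2               ≡⟨ identity (A ℤ.* Wpoly m A) ⟨
    A ℤ.* Wpoly m A                                 ∎
    where
    open ≡-Reasoning
    identity : ∀ w → w ≡ (w ℤ.+ + 2) ℤ.- + 2
    identity = ℤ-Ring.solve-∀

double-suc : ∀ m → 2 * suc m ≡ suc (suc (2 * m))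
double-suc m = cong suc (+-suc m (m + 0))

lucas-step : ∀ j → + Lucas (4 + j) ≡ + 3 ℤ.* + Lucas (2 + j) ℤ.- + Lucas j
lucas-step j = begin
  + Lucas (4 + j)                                ≡⟨ identity (+ Lucas (4 + j)) (+ Lucas j) ⟩
  (+ Lucas (4 + j) ℤ.+ + Lucas j) ℤ.- + Lucas j  ≡⟨ cong (ℤ._- + Lucas j) (pos-+ (Lucas (4 + j)) (Lucas j)) ⟨
  + (Lucas (4 + j) + Lucas j) ℤ.- + Lucas j      ≡⟨ cong (λ u → + u ℤ.- + Lucas j) (unfolded (Lucas (suc j)) (Lucas j)) ⟩
  + (3 * Lucas (2 + j)) ℤ.- + Lucas j            ≡⟨ cong (ℤ._- + Lucas j) (pos-* 3 (Lucas (2 + j))) ⟩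
  + 3 ℤ.* + Lucas (2 + j) ℤ.- + Lucas j          ∎
  where
  open ≡-Reasoning
  identity : ∀ u v → u ≡ (u ℤ.+ v) ℤ.- v
  identity = ℤ-Ring.solve-∀
  unfolded : ∀ p q → (((p + q) + p) + (p + q)) + q ≡ 3 * (p + q)
  unfolded = ℕ-Ring.solve-∀

evenLucas : ℕ → ℤ
evenLucas m = + Lucas (2 * m)

evenLucas-rec : SatisfiesRecurrence (+ 3) evenLucas
evenLucas-rec m = begin
  + Lucas (2 * suc (suc m))                        ≡⟨ cong (+_ ∘ Lucas) (trans (double-suc (suc m)) (cong (λ j → 2 + j) (double-suc m))) ⟩
  + Lucas (4 + 2 * m)                              ≡⟨ lucas-step (2 * m) ⟩
  + 3 ℤ.* + Lucas (2 + 2 * m) ℤ.- + Lucas (2 * m)  ≡⟨ cong (λ i → + 3 ℤ.* + Lucas i ℤ.- + Lucas (2 * m)) (double-suc m) ⟨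
  + 3 ℤ.* + Lucas (2 * suc m) ℤ.- + Lucas (2 * m)  ∎
  where open ≡-Reasoning

cyclicRuns-Lucas : ∀ m → Counting.cyclicRuns 1 m ≡ Lucas (2 * m) ∸ 2
cyclicRuns-Lucas m = trans (sym (m+n∸n≡m (cyclicRuns m) 2)) (cong (_∸ 2) (+-injective (begin
  + (cyclicRuns m + 2)      ≡⟨ pos-+ (cyclicRuns m) 2 ⟩
  + cyclicRuns m ℤ.+ + 2    ≡⟨ cyclicRuns-trace m ⟩
  trace m                   ≡⟨ recurrence-unique {+ 3} {trace} {evenLucas} trace-rec evenLucas-rec refl refl m ⟩
  + Lucas (2 * m)           ∎)))
  where
  open ≡-Reasoning
  open Counting 1
  open Trace 1

wheel-spanningTrees : ∀ a k → Wbar a (suc k) hasSpanningTreeCount Counting.cyclicRuns a (suc k)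
wheel-spanningTrees a k = ↔-trans (Bijection.spanningTree↔accepted a k) (Counting.cyclicRuns↔ a (suc k))

theorem5p10 : (a n : ℕ) → 1 ≤ a → 2 ≤ n →
    (Σ[ t ∈ ℕ ] (Wbar a n hasSpanningTreeCount t × (+ t) ≡ (+ a) ℤ.* Wpoly (n ∸ 1) (+ a)))
    × Wbar 1 n hasSpanningTreeCount (Lucas (2 * n) ∸ 2)
theorem5p10 a (suc k) _ _ =
  (Counting.cyclicRuns a (suc k) , wheel-spanningTrees a k , Trace.cyclicRuns-Wpoly a k) ,
  subst (Wbar 1 (suc k) hasSpanningTreeCount_) (cyclicRuns-Lucas (suc k)) (wheel-spanningTrees 1 k)
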